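{- There exists a sequence $(\mathcal{H}_i)$ of 4-uniform 2-hypertrees, where $\mathcal{H}_i$ has $n_i$ vertices and $e_i$ edges, with $n_i\to\infty$ and $e_i/\binom{n_i}{3}\to \frac{2}{7}$.
   Context: A $k$-uniform hypergraph $\mathcal{H}=(V,\mathcal{E})$ consists of a finite vertex set $V$ and a set $\mathcal{E}$ of $k$-element subsets of $V$ (no multiple edges). A $k$-uniform hypergraph is a chain if there is a sequence $v_1,\dots,v_l$ of its vertices in which every vertex appears at least once (possibly more times), $v_1\ne v_l$, and its edge set consists of exactly the $l-k+1$ distinct sets $\{v_i,\dots,v_{i+k-1}\}$, $1\le i\le l-k+1$; it is a semicycle if the same holds with $v_1=v_l$ instead. The length of a chain is its number of edges. $\mathcal{H}$ is chain-connected if every pair of distinct vertices is contained in some subhypergraph that is a chain; semicycle-free if no subhypergraph is a semicycle. A hypertree is a chain-connected, semicycle-free $k$-uniform hypergraph; a 2-hypertree is a hypertree in which every chain (subhypergraph) has length at most 2. -}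

module Defs where

open import Data.Nat using (ℕ; zero; suc; _≤_; _≤?_; _<_; NonZero)
open import Data.Nat.Combinatorics using (_C_)
open import Data.Fin using (Fin)
open import Data.Fin.Subset using (Subset; ⁅_⁆; _∪_; ⊥; ∣_∣)
open import Data.List using (List; []; _∷_; length; take; map; head; last)
open import Data.List.Membership.Propositional using (_∈_)
open import Data.List.Relation.Unary.All using (All)
open import Data.List.Relation.Unary.Unique.Propositional using (Unique)
open import Data.Product using (Σ; _×_; ∃; ∃-syntax)
open import Data.Integer using (+_)
open import Data.Rational using (ℚ; _/_; _-_; 0ℚ) renaming (∣_∣ to abs; _<_ to _<ℚ_)
open import Relation.Binary.PropositionalEquality using (_≡_; _≢_)
open import Relation.Nullary using (¬_; yes; no)

record Hypergraph (k : ℕ) : Set where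
  field
    n        : ℕ
    edges    : List (Subset n)
    distinct : Unique edges
    uniform  : All (λ e → ∣ e ∣ ≡ k) edges
open Hypergraph public

#edges : ∀ {k} → Hypergraph k → ℕ
#edges H = length (edges H)

toSub : ∀ {n} → List (Fin n) → Subset n
toSub []       = ⊥
toSub (v ∷ vs) = ⁅ v ⁆ ∪ toSub vs

windows : ∀ {A : Set} → ℕ → List A → List (List A)
windows k []       = []
windows k (x ∷ xs) with k ≤? length (x ∷ xs)
... | yes _ = take k (x ∷ xs) ∷ windows k xs
... | no  _ = []

windowSets : ∀ {n} → ℕ → List (Fin n) → List (Subset n)
windowSets k vs = map toSub (windows k vs)

-- The sequence vs determines a sub-hypergraph of H (vertex set = entries of vs,
-- edge set = the windows) whose windows are l-k+1 ≥ 1 distinct edges of H.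
IsWindowSubgraph : ∀ {k} (H : Hypergraph k) → List (Fin (n H)) → Set
IsWindowSubgraph {k} H vs =
  (1 ≤ length (windows k vs)) ×
  Unique (windowSets k vs) ×
  All (λ e → e ∈ edges H) (windowSets k vs)

IsChainSeq : ∀ {k} (H : Hypergraph k) → List (Fin (n H)) → Set
IsChainSeq H vs = IsWindowSubgraph H vs × (head vs ≢ last vs)

IsSemicycleSeq : ∀ {k} (H : Hypergraph k) → List (Fin (n H)) → Set
IsSemicycleSeq H vs = IsWindowSubgraph H vs × (head vs ≡ last vs)

chainLength : ∀ {n} → ℕ → List (Fin n) → ℕ
chainLength k vs = length (windows k vs)

ChainConnected : ∀ {k} → Hypergraph k → Set
ChainConnected H =
  (u v : Fin (n H)) → u ≢ v →
  ∃[ vs ] (IsChainSeq H vs × u ∈ vs × v ∈ vs)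

SemicycleFree : ∀ {k} → Hypergraph k → Set
SemicycleFree H = (vs : List (Fin (n H))) → ¬ IsSemicycleSeq H vs

IsHypertree : ∀ {k} → Hypergraph k → Set
IsHypertree H = ChainConnected H × SemicycleFree H

Is2Hypertree : ∀ {k} → Hypergraph k → Set
Is2Hypertree {k} H =
  IsHypertree H ×
  ((vs : List (Fin (n H))) → IsChainSeq H vs → chainLength k vs ≤ 2)

TendsToInfinity : (ℕ → ℕ) → Set
TendsToInfinity a = (M : ℕ) → ∃[ N ] ((i : ℕ) → N ≤ i → M ≤ a i)

-- e_i / d_i → q  (d_i is eventually nonzero, so the quotient is eventually defined)
RatioTendsTo : (ℕ → ℕ) → (ℕ → ℕ) → ℚ → Set
RatioTendsTo e d q =
  (ε : ℚ) → 0ℚ <ℚ ε →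
  ∃[ N ] ((i : ℕ) → N ≤ i →
    Σ (NonZero (d i)) λ nz →
      abs (((+ e i) / d i) {{nz}} - q) <ℚ ε)

module Submission where

-- The vertices are the nonzero vectors of F₂^k, that is the
-- numbers 1, …, 2^k − 1 under bitwise exclusive or ⊕.  For every line {b ⊕ c, b, c}
-- (b < c in a common dyadic block [2^j, 2^(j+1)), so that b ⊕ c < b < c) and every apex
-- x with c < x < 2^k, the set {b ⊕ c, b, c, x} is an edge.
--
-- The ⊕-sum of an edge is its apex, which is also its largest vertex.  If
-- two different edges S ∪ {p} and S ∪ {q} share three vertices S, comparing ⊕-sums and
-- maxima shows that p is the apex of the first edge (apex-private).  For three
-- consecutive windows of a vertex sequence the apex of the middle edge would then be both
-- its first and its last vertex; hence every chain has at most two edges and there is no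
-- semicycle (shorter semicycles repeat a vertex inside an edge or repeat an edge).  Any two
-- vertices lie on a common edge, which is a chain (cover).
--
-- Counting.  With m = 2^k there are (m − 1)(m − 2)(m − 4)/21 edges on n = m − 1
-- vertices, against C(n, 3) = (m − 1)(m − 2)(m − 3)/6 triples; the ratio tends to 2/7.

open import Data.Nat using (ℕ; _≤_)

module Xor where

  open import Data.Bool using (Bool; true; false; _xor_)
  open import Data.Bool.Properties using (xor-assoc; xor-comm; xor-same)
  open import Data.Nat
  open import Data.Nat.Properties
  open import Data.Nat.Tactic.RingSolver using (solve-∀)
  open import Relation.Binary.PropositionalEquality

  bit : Bool → ℕ
  bit false = 0
  bit true  = 1

  bin : Bool → ℕ → ℕ
  bin b m = bit b + 2 * m

  lowBit : ℕ → Bool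
  lowBit zero          = false
  lowBit (suc zero)    = true
  lowBit (suc (suc n)) = lowBit n

  half : ℕ → ℕ
  half zero          = zero
  half (suc zero)    = zero
  half (suc (suc n)) = suc (half n)

  -- The step that lets lowBit and half compute on bin b m.
  bin-suc : ∀ b m → bin b (suc m) ≡ suc (suc (bin b m))
  bin-suc b m = shift (bit b) m
    where
    shift : ∀ a m → a + 2 * suc m ≡ suc (suc (a + 2 * m))
    shift = solve-∀

  lowBit-bin : ∀ b m → lowBit (bin b m) ≡ b
  lowBit-bin false zero = refl
  lowBit-bin true  zero = refl
  lowBit-bin b (suc m) rewrite bin-suc b m = lowBit-bin b m

  half-bin : ∀ b m → half (bin b m) ≡ m
  half-bin false zero = refl
  half-bin true  zero = refl
  half-bin b (suc m) rewrite bin-suc b m = cong suc (half-bin b m)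

  bin-lowBit-half : ∀ n → bin (lowBit n) (half n) ≡ n
  bin-lowBit-half zero          = refl
  bin-lowBit-half (suc zero)    = refl
  bin-lowBit-half (suc (suc n)) =
    trans (bin-suc (lowBit n) (half n)) (cong (λ m → suc (suc m)) (bin-lowBit-half n))

  bin-< : ∀ b {m M} → m < M → bin b m < 2 * M
  bin-< b {m} {M} m<M = begin-strict
    bit b + 2 * m   ≤⟨ +-monoˡ-≤ (2 * m) (bit≤1 b) ⟩
    1 + 2 * m       <⟨ n<1+n (1 + 2 * m) ⟩
    2 + 2 * m       ≡⟨ *-suc 2 m ⟨
    2 * suc m       ≤⟨ *-monoʳ-≤ 2 m<M ⟩
    2 * M           ∎
    where
    open ≤-Reasoning
    bit≤1 : ∀ b → bit b ≤ 1
    bit≤1 false = z≤n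
    bit≤1 true  = s≤s z≤n

  half-< : ∀ {n M} → n < 2 * M → half n < M
  half-< {n} {M} n<2M = *-cancelˡ-< 2 (half n) M (begin-strict
    2 * half n                  ≤⟨ m≤n+m (2 * half n) (bit (lowBit n)) ⟩
    bin (lowBit n) (half n)     ≡⟨ bin-lowBit-half n ⟩
    n                           <⟨ n<2M ⟩
    2 * M                       ∎)
    where open ≤-Reasoning

  half-≥ : ∀ {n M} → 2 * M ≤ n → M ≤ half n
  half-≥ {n} {M} 2M≤n = ≮⇒≥ λ h<M →
    <⇒≱ (subst (_< 2 * M) (bin-lowBit-half n) (bin-< (lowBit n) h<M)) 2M≤n

  -- Bitwise exclusive or of the lowest k binary digits: addition in F₂^k, where a
  -- number below 2^k is read as the vector of its binary digits.
  bxor : ℕ → ℕ → ℕ → ℕ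
  bxor zero    a b = 0
  bxor (suc k) a b = bin (lowBit a xor lowBit b) (bxor k (half a) (half b))

  bxor-< : ∀ k a b → bxor k a b < 2 ^ k
  bxor-< zero    a b = s≤s z≤n
  bxor-< (suc k) a b = bin-< (lowBit a xor lowBit b) (bxor-< k (half a) (half b))

  bxor-comm : ∀ k a b → bxor k a b ≡ bxor k b a
  bxor-comm zero    a b = refl
  bxor-comm (suc k) a b =
    cong₂ bin (xor-comm (lowBit a) (lowBit b)) (bxor-comm k (half a) (half b))

  bxor-assoc : ∀ k a b c → bxor k (bxor k a b) c ≡ bxor k a (bxor k b c)
  bxor-assoc zero    a b c = refl
  bxor-assoc (suc k) a b c = begin
    bxor (suc k) (bxor (suc k) a b) c
      ≡⟨ cong₂ bin (cong (_xor lowBit c) (lowBit-bin ab (bxor k (half a) (half b))))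
                   (cong (λ h → bxor k h (half c)) (half-bin ab (bxor k (half a) (half b)))) ⟩
    bin ((lowBit a xor lowBit b) xor lowBit c) (bxor k (bxor k (half a) (half b)) (half c))
      ≡⟨ cong₂ bin (xor-assoc (lowBit a) (lowBit b) (lowBit c)) (bxor-assoc k (half a) (half b) (half c)) ⟩
    bin (lowBit a xor (lowBit b xor lowBit c)) (bxor k (half a) (bxor k (half b) (half c)))
      ≡⟨ cong₂ bin (cong (lowBit a xor_) (lowBit-bin bc (bxor k (half b) (half c))))
                   (cong (bxor k (half a)) (half-bin bc (bxor k (half b) (half c)))) ⟨
    bxor (suc k) a (bxor (suc k) b c) ∎
    where
    open ≡-Reasoning
    ab = lowBit a xor lowBit b
    bc = lowBit b xor lowBit c

  bxor-self : ∀ k a → bxor k a a ≡ 0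
  bxor-self zero    a = refl
  bxor-self (suc k) a = cong₂ bin (xor-same (lowBit a)) (bxor-self k (half a))

  bxor-identityˡ : ∀ k {a} → a < 2 ^ k → bxor k 0 a ≡ a
  bxor-identityˡ zero    {zero}  _         = refl
  bxor-identityˡ zero    {suc _} (s≤s ())
  bxor-identityˡ (suc k) {a} a<2^k =
    trans (cong (bin (lowBit a)) (bxor-identityˡ k (half-< a<2^k))) (bin-lowBit-half a)

  -- Two numbers with the same leading binary digit 2^j have exclusive or below 2^j:
  -- in a line {b ⊕ c, b, c} with b < c in one dyadic block, b ⊕ c is the smallest point.
  bxor-block : ∀ j k {b c} → 2 ^ j ≤ b → b < 2 ^ suc j → 2 ^ j ≤ c → c < 2 ^ suc j →
               bxor k b c < 2 ^ j
  bxor-block zero k {suc zero} {suc zero} _ _ _ _ = subst (_< 1) (sym (bxor-self k 1)) (s≤s z≤n)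
  bxor-block zero k {suc (suc _)} _ (s≤s (s≤s ())) _ _
  bxor-block zero k {suc zero} {suc (suc _)} _ _ _ (s≤s (s≤s ()))
  bxor-block (suc j) zero    _ _ _ _ = m^n>0 2 (suc j)
  bxor-block (suc j) (suc k) {b} {c} 2^j≤b b<2^j 2^j≤c c<2^j =
    bin-< (lowBit b xor lowBit c) (bxor-block j k (half-≥ 2^j≤b) (half-< b<2^j) (half-≥ 2^j≤c) (half-< c<2^j))

  module _ (k : ℕ) where

    private
      _⊕_ : ℕ → ℕ → ℕ
      _⊕_ = bxor k

    bxor-identityʳ : ∀ {a} → a < 2 ^ k → a ⊕ 0 ≡ a
    bxor-identityʳ {a} a< = trans (bxor-comm k a 0) (bxor-identityˡ k a<)

    bxor-cancelʳ : ∀ {a} b → a < 2 ^ k → (a ⊕ b) ⊕ b ≡ a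
    bxor-cancelʳ {a} b a< = begin
      (a ⊕ b) ⊕ b  ≡⟨ bxor-assoc k a b b ⟩
      a ⊕ (b ⊕ b)  ≡⟨ cong (a ⊕_) (bxor-self k b) ⟩
      a ⊕ 0        ≡⟨ bxor-identityʳ a< ⟩
      a            ∎
      where open ≡-Reasoning

    bxor-cancelˡ : ∀ a {b} → b < 2 ^ k → a ⊕ (a ⊕ b) ≡ b
    bxor-cancelˡ a {b} b< = begin
      a ⊕ (a ⊕ b)  ≡⟨ bxor-assoc k a a b ⟨
      (a ⊕ a) ⊕ b  ≡⟨ cong (_⊕ b) (bxor-self k a) ⟩
      0 ⊕ b        ≡⟨ bxor-identityˡ k b< ⟩
      b            ∎
      where open ≡-Reasoning

    bxor-injectiveˡ : ∀ {a b} c → a < 2 ^ k → b < 2 ^ k → a ⊕ c ≡ b ⊕ c → a ≡ b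
    bxor-injectiveˡ {a} {b} c a< b< eq =
      trans (sym (bxor-cancelʳ c a<)) (trans (cong (_⊕ c) eq) (bxor-cancelʳ c b<))

    bxor≡0⇒≡ : ∀ {a b} → a < 2 ^ k → b < 2 ^ k → a ⊕ b ≡ 0 → a ≡ b
    bxor≡0⇒≡ {a} {b} a< b< eq =
      trans (sym (bxor-cancelʳ b a<)) (trans (cong (_⊕ b) eq) (bxor-identityˡ k b<))

  bxor-2-3 : ∀ k → 2 ≤ k → bxor k 2 3 ≡ 1
  bxor-2-3 (suc zero)    (s≤s ())
  bxor-2-3 (suc (suc k)) _ = cong (λ z → bin true (bin false z)) (bxor-self k 0)

module FinSet where

  open import Data.Nat using (ℕ; zero; suc; _≤_; s≤s)
  open import Data.Nat.Properties using (≤-trans; n≤1+n; suc-injective; <-irrefl; ≤-reflexive)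
  open import Data.Fin using (Fin; zero; suc)
  open import Data.Fin.Subset using (Subset; ⁅_⁆; _∪_; ⊥; ∣_∣; inside; outside; _∉_)
    renaming (_∈_ to _∈ₛ_)
  open import Data.Fin.Subset.Properties
    using (x∈p∪q⁻; x∈p∪q⁺; x∈⁅x⁆; x∈⁅y⁆⇒x≡y; ∉⊥; ⊆-antisym; ∪-identityˡ; ∪-assoc; ∪-comm; q⊆p∪q; _∈?_; ∣⊥∣≡0)
  open import Data.Vec.Base using (_∷_; [])
  import Data.Vec.Base as Vec
  open import Data.List using (List; []; _∷_; _∷ʳ_; length; foldr; map)
  open import Data.List.Membership.Propositional using (_∈_)
  open import Data.List.Relation.Unary.Any using (here; there)
  open import Data.List.Relation.Unary.All using (All)
  import Data.List.Relation.Unary.All as All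
  open import Data.List.Relation.Unary.Unique.Propositional using (Unique)
  open import Data.List.Relation.Unary.AllPairs using ([]; _∷_)
  open import Data.Sum using (inj₁; inj₂)
  open import Data.Empty using (⊥-elim)
  open import Relation.Nullary using (yes; no)
  open import Algebra.Definitions using (Commutative; Associative)
  open import Relation.Binary.PropositionalEquality
  open import Defs using (toSub)

  ∈-toSub⁺ : ∀ {n} {i : Fin n} {xs} → i ∈ xs → i ∈ₛ toSub xs
  ∈-toSub⁺ (here refl) = x∈p∪q⁺ (inj₁ (x∈⁅x⁆ _))
  ∈-toSub⁺ (there i∈)  = x∈p∪q⁺ (inj₂ (∈-toSub⁺ i∈))

  ∈-toSub⁻ : ∀ {n} {i : Fin n} xs → i ∈ₛ toSub xs → i ∈ xs
  ∈-toSub⁻ []       i∈ = ⊥-elim (∉⊥ i∈)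
  ∈-toSub⁻ (x ∷ xs) i∈ with x∈p∪q⁻ ⁅ x ⁆ (toSub xs) i∈
  ... | inj₁ i∈x  = here (x∈⁅y⁆⇒x≡y x i∈x)
  ... | inj₂ i∈xs = there (∈-toSub⁻ xs i∈xs)

  toSub-∷ʳ : ∀ {n} (xs : List (Fin n)) x → toSub (xs ∷ʳ x) ≡ toSub (x ∷ xs)
  toSub-∷ʳ []       x = refl
  toSub-∷ʳ (y ∷ xs) x = begin
    ⁅ y ⁆ ∪ toSub (xs ∷ʳ x)      ≡⟨ cong (⁅ y ⁆ ∪_) (toSub-∷ʳ xs x) ⟩
    ⁅ y ⁆ ∪ (⁅ x ⁆ ∪ toSub xs)   ≡⟨ ∪-assoc ⁅ y ⁆ ⁅ x ⁆ (toSub xs) ⟨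
    (⁅ y ⁆ ∪ ⁅ x ⁆) ∪ toSub xs   ≡⟨ cong (_∪ toSub xs) (∪-comm ⁅ y ⁆ ⁅ x ⁆) ⟩
    (⁅ x ⁆ ∪ ⁅ y ⁆) ∪ toSub xs   ≡⟨ ∪-assoc ⁅ x ⁆ ⁅ y ⁆ (toSub xs) ⟩
    ⁅ x ⁆ ∪ (⁅ y ⁆ ∪ toSub xs)   ∎
    where open ≡-Reasoning

  ∣⁅x⁆∪p∣ : ∀ {n} (x : Fin n) p → x ∉ p → ∣ ⁅ x ⁆ ∪ p ∣ ≡ suc ∣ p ∣
  ∣⁅x⁆∪p∣ zero    (inside  ∷ p) x∉p = ⊥-elim (x∉p Vec.here)
  ∣⁅x⁆∪p∣ zero    (outside ∷ p) x∉p = cong (λ q → suc ∣ q ∣) (∪-identityˡ p)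
  ∣⁅x⁆∪p∣ (suc x) (inside  ∷ p) x∉p = cong suc (∣⁅x⁆∪p∣ x p (λ x∈p → x∉p (Vec.there x∈p)))
  ∣⁅x⁆∪p∣ (suc x) (outside ∷ p) x∉p = ∣⁅x⁆∪p∣ x p (λ x∈p → x∉p (Vec.there x∈p))

  ⁅x⁆∪p≡p : ∀ {n} {x : Fin n} {p} → x ∈ₛ p → ⁅ x ⁆ ∪ p ≡ p
  ⁅x⁆∪p≡p {x = x} {p} x∈p = ⊆-antisym ⊆p (q⊆p∪q ⁅ x ⁆ p)
    where
    ⊆p : ∀ {y} → y ∈ₛ ⁅ x ⁆ ∪ p → y ∈ₛ p
    ⊆p y∈ with x∈p∪q⁻ ⁅ x ⁆ p y∈
    ... | inj₁ y∈x = subst (_∈ₛ p) (sym (x∈⁅y⁆⇒x≡y x y∈x)) x∈p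
    ... | inj₂ y∈p = y∈p

  ∣toSub∣≤length : ∀ {n} (xs : List (Fin n)) → ∣ toSub xs ∣ ≤ length xs
  ∣toSub∣≤length {n} []       = ≤-reflexive (∣⊥∣≡0 n)
  ∣toSub∣≤length (x ∷ xs) with x ∈? toSub xs
  ... | yes x∈ = subst (_≤ suc (length xs)) (sym (cong ∣_∣ (⁅x⁆∪p≡p x∈)))
                   (≤-trans (∣toSub∣≤length xs) (n≤1+n _))
  ... | no  x∉ = subst (_≤ suc (length xs)) (sym (∣⁅x⁆∪p∣ x (toSub xs) x∉)) (s≤s (∣toSub∣≤length xs))

  ∣toSub∣≡length⇒Unique : ∀ {n} (xs : List (Fin n)) → ∣ toSub xs ∣ ≡ length xs → Unique xs
  ∣toSub∣≡length⇒Unique []       _  = []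
  ∣toSub∣≡length⇒Unique (x ∷ xs) eq with x ∈? toSub xs
  ... | yes x∈ = ⊥-elim (<-irrefl refl (≤-trans (≤-reflexive (sym eq′)) (∣toSub∣≤length xs)))
    where
    eq′ : ∣ toSub xs ∣ ≡ suc (length xs)
    eq′ = trans (sym (cong ∣_∣ (⁅x⁆∪p≡p x∈))) eq
  ... | no  x∉ = All.tabulate (λ y∈ x≡y → x∉ (∈-toSub⁺ (subst (_∈ xs) (sym x≡y) y∈)))
               ∷ ∣toSub∣≡length⇒Unique xs (suc-injective (trans (sym (∣⁅x⁆∪p∣ x (toSub xs) x∉)) eq))

  Unique⇒∣toSub∣≡length : ∀ {n} {xs : List (Fin n)} → Unique xs → ∣ toSub xs ∣ ≡ length xs
  Unique⇒∣toSub∣≡length {n} {xs = []}     []         = ∣⊥∣≡0 n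
  Unique⇒∣toSub∣≡length {xs = x ∷ xs} (x∉xs ∷ u) =
    trans (∣⁅x⁆∪p∣ x (toSub xs) λ x∈ → All.lookup x∉xs (∈-toSub⁻ xs x∈) refl)
          (cong suc (Unique⇒∣toSub∣≡length u))

  module SubsetFold {A : Set} (_∙_ : A → A → A) (ε : A)
                    (comm : Commutative _≡_ _∙_) (assoc : Associative _≡_ _∙_) where

    ⨁ : ∀ {n} → (Fin n → A) → Subset n → A
    ⨁ f []            = ε
    ⨁ f (outside ∷ p) = ⨁ (λ i → f (suc i)) p
    ⨁ f (inside  ∷ p) = f zero ∙ ⨁ (λ i → f (suc i)) p

    ⨁-⊥ : ∀ n (f : Fin n → A) → ⨁ f ⊥ ≡ ε
    ⨁-⊥ zero    f = refl
    ⨁-⊥ (suc n) f = ⨁-⊥ n (λ i → f (suc i))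

    ⨁-insert : ∀ {n} (f : Fin n → A) x p → x ∉ p → ⨁ f (⁅ x ⁆ ∪ p) ≡ f x ∙ ⨁ f p
    ⨁-insert f zero    (inside  ∷ p) x∉p = ⊥-elim (x∉p Vec.here)
    ⨁-insert f zero    (outside ∷ p) x∉p = cong (λ q → f zero ∙ ⨁ (λ i → f (suc i)) q) (∪-identityˡ p)
    ⨁-insert f (suc x) (outside ∷ p) x∉p = ⨁-insert (λ i → f (suc i)) x p (λ x∈p → x∉p (Vec.there x∈p))
    ⨁-insert f (suc x) (inside  ∷ p) x∉p = begin
      f zero ∙ ⨁ f′ (⁅ x ⁆ ∪ p)   ≡⟨ cong (f zero ∙_) (⨁-insert f′ x p (λ x∈p → x∉p (Vec.there x∈p))) ⟩
      f zero ∙ (f′ x ∙ ⨁ f′ p)    ≡⟨ assoc (f zero) (f′ x) (⨁ f′ p) ⟨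
      (f zero ∙ f′ x) ∙ ⨁ f′ p    ≡⟨ cong (_∙ ⨁ f′ p) (comm (f zero) (f′ x)) ⟩
      (f′ x ∙ f zero) ∙ ⨁ f′ p    ≡⟨ assoc (f′ x) (f zero) (⨁ f′ p) ⟩
      f′ x ∙ (f zero ∙ ⨁ f′ p)    ∎
      where
      open ≡-Reasoning
      f′ : Fin _ → A
      f′ i = f (suc i)

    ⨁-toSub : ∀ {n} (f : Fin n → A) {xs} → Unique xs → ⨁ f (toSub xs) ≡ foldr _∙_ ε (map f xs)
    ⨁-toSub {n} f {[]}     []         = ⨁-⊥ n f
    ⨁-toSub     f {x ∷ xs} (x∉xs ∷ u) =
      trans (⨁-insert f x (toSub xs) λ x∈ → All.lookup x∉xs (∈-toSub⁻ xs x∈) refl)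
            (cong (f x ∙_) (⨁-toSub f u))

module Lists where

  open import Data.Nat using (ℕ; _<_; _≤_; _+_; _*_)
  open import Data.Nat.Properties using (<⇒≱; <-asym; <-irrefl)
  open import Data.List using (List; []; _∷_; _++_; map; length; cartesianProductWith)
  open import Data.List.Properties using (length-++; length-map)
  open import Data.List.Membership.Propositional using (_∈_)
  open import Data.List.Relation.Unary.Any using (here; there)
  open import Data.List.Relation.Unary.All using (All; []; _∷_)
  import Data.List.Relation.Unary.All as All
  import Data.List.Relation.Unary.All.Properties as Allₚ
  open import Data.List.Relation.Unary.AllPairs using (AllPairs; []; _∷_)
  open import Data.List.Relation.Unary.Unique.Propositional using (Unique)
  import Data.List.Relation.Unary.Unique.Propositional.Properties as Unique
  open import Data.Product using (_,_)
  open import Data.Empty using (⊥-elim)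
  open import Function using (case_of_)
  open import Relation.Binary.PropositionalEquality

  Unique-++-separated : ∀ {A : Set} (key : A → ℕ) m {xs ys : List A} → Unique xs → Unique ys →
                        (∀ {a} → a ∈ xs → key a < m) → (∀ {a} → a ∈ ys → m ≤ key a) →
                        Unique (xs ++ ys)
  Unique-++-separated key m uxs uys below above =
    Unique.++⁺ uxs uys λ (a∈xs , a∈ys) → <⇒≱ (below a∈xs) (above a∈ys)

  Unique-map-on : ∀ {A B : Set} (f : A → B) {xs} → Unique xs →
                  (∀ {a b} → a ∈ xs → b ∈ xs → f a ≡ f b → a ≡ b) → Unique (map f xs)
  Unique-map-on f {[]}     []         inj = []
  Unique-map-on f {x ∷ xs} (x∉ ∷ uxs) inj =
    Allₚ.map⁺ (All.tabulate λ y∈ fx≡fy → All.lookup x∉ y∈ (inj (here refl) (there y∈) fx≡fy))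
    ∷ Unique-map-on f uxs (λ a∈ b∈ → inj (there a∈) (there b∈))

  increasing-ext : ∀ {xs ys : List ℕ} → AllPairs _<_ xs → AllPairs _<_ ys →
                   (∀ {z} → z ∈ xs → z ∈ ys) → (∀ {z} → z ∈ ys → z ∈ xs) → xs ≡ ys
  increasing-ext []          []          _ _ = refl
  increasing-ext []          (_ ∷ _)     _ ⊇ = case ⊇ (here refl) of λ ()
  increasing-ext (_ ∷ _)     []          ⊆ _ = case ⊆ (here refl) of λ ()
  increasing-ext {x ∷ xs} {y ∷ ys} (x< ∷ xs↑) (y< ∷ ys↑) ⊆ ⊇ =
    cong₂ _∷_ x≡y (increasing-ext xs↑ ys↑ ⊆′ ⊇′)
    where
    x≡y : x ≡ y
    x≡y with ⊆ (here refl) | ⊇ (here refl)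
    ... | here x≡y   | _          = x≡y
    ... | there _    | here y≡x   = sym y≡x
    ... | there x∈ys | there y∈xs = ⊥-elim (<-asym (All.lookup y< x∈ys) (All.lookup x< y∈xs))
    ⊆′ : ∀ {z} → z ∈ xs → z ∈ ys
    ⊆′ z∈ with ⊆ (there z∈)
    ... | here z≡y   = ⊥-elim (<-irrefl (trans x≡y (sym z≡y)) (All.lookup x< z∈))
    ... | there z∈ys = z∈ys
    ⊇′ : ∀ {z} → z ∈ ys → z ∈ xs
    ⊇′ z∈ with ⊇ (there z∈)
    ... | here z≡x   = ⊥-elim (<-irrefl (trans (sym x≡y) (sym z≡x)) (All.lookup y< z∈))
    ... | there z∈xs = z∈xs

  length-cartesianProductWith : ∀ {A B C : Set} (f : A → B → C) xs ys →
    length (cartesianProductWith f xs ys) ≡ length xs * length ys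
  length-cartesianProductWith f []       ys = refl
  length-cartesianProductWith f (x ∷ xs) ys =
    trans (length-++ (map (f x) ys))
          (cong₂ _+_ (length-map (f x) ys) (length-cartesianProductWith f xs ys))

module Enumeration where

  open import Data.Nat
  open import Data.Nat.Properties
  open import Data.Nat.Combinatorics using (_C_; nCk+nC[k+1]≡[n+1]C[k+1]; nC1≡n)
  open import Data.Nat.Tactic.RingSolver using (solve-∀)
  open import Data.List using (List; []; _∷_; _++_; map; length; upTo; cartesianProductWith)
  open import Data.List.Properties using (length-++; length-map; length-upTo)
  open import Data.List.Membership.Propositional using (_∈_)
  open import Data.List.Membership.Propositional.Properties
    using (∈-map⁺; ∈-map⁻; ∈-++⁺ˡ; ∈-++⁺ʳ; ∈-++⁻; ∈-upTo⁺; ∈-upTo⁻; ∈-cartesianProductWith⁺; ∈-cartesianProductWith⁻)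
  open import Data.List.Relation.Unary.Unique.Propositional using (Unique)
  open import Data.List.Relation.Unary.AllPairs using ([])
  import Data.List.Relation.Unary.Unique.Propositional.Properties as Unique
  import Data.List.Relation.Unary.Unique.Setoid.Properties as UniqueS
  open import Data.Product using (_×_; _,_; proj₁; proj₂; Σ-syntax)
  open import Data.Sum using (inj₁; inj₂)
  open import Data.Empty using (⊥-elim)
  open import Relation.Nullary using (yes; no)
  open import Function using (case_of_; _∘_)
  open import Relation.Binary.Definitions using (tri<; tri≈; tri>)
  open import Relation.Binary.PropositionalEquality
  open Lists using (Unique-++-separated; length-cartesianProductWith)

  shift-< : ∀ m {y} → y < m → m + y < 2 * m
  shift-< m {y} y<m = subst (m + y <_) (cong (m +_) (sym (+-identityʳ m))) (+-monoʳ-< m y<m)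

  unshift-< : ∀ m {x} → m ≤ x → x < 2 * m → x ∸ m < m
  unshift-< m {x} m≤x x<2m = +-cancelˡ-< m (x ∸ m) m (begin-strict
    m + (x ∸ m)  ≡⟨ m+[n∸m]≡n m≤x ⟩
    x            <⟨ x<2m ⟩
    2 * m        ≡⟨ cong (m +_) (+-identityʳ m) ⟩
    m + m        ∎)
    where open ≤-Reasoning

  pairs : ℕ → List (ℕ × ℕ)
  pairs zero    = []
  pairs (suc m) = pairs m ++ map (_, m) (upTo m)

  ∈-pairs⁻ : ∀ {m p q} → (p , q) ∈ pairs m → p < q × q < m
  ∈-pairs⁻ {suc m} pq∈ with ∈-++⁻ (pairs m) pq∈
  ... | inj₁ old = let p<q , q<m = ∈-pairs⁻ old in p<q , m<n⇒m<1+n q<m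
  ... | inj₂ new with _ , p∈ , refl ← ∈-map⁻ (_, m) new = ∈-upTo⁻ p∈ , n<1+n m

  ∈-pairs⁺ : ∀ {m p q} → p < q → q < m → (p , q) ∈ pairs m
  ∈-pairs⁺ {suc m} p<q q<1+m with m≤n⇒m<n∨m≡n (s≤s⁻¹ q<1+m)
  ... | inj₁ q<m  = ∈-++⁺ˡ (∈-pairs⁺ p<q q<m)
  ... | inj₂ refl = ∈-++⁺ʳ (pairs m) (∈-map⁺ (_, m) (∈-upTo⁺ p<q))

  pairs-Unique : ∀ m → Unique (pairs m)
  pairs-Unique zero    = []
  pairs-Unique (suc m) =
    Unique-++-separated proj₂ m (pairs-Unique m) (Unique.map⁺ (cong proj₁) (Unique.upTo⁺ m))
      (λ pq∈ → proj₂ (∈-pairs⁻ pq∈))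
      (λ pq∈ → case ∈-map⁻ (_, m) pq∈ of λ { (_ , _ , refl) → ≤-refl })

  length-pairs : ∀ m → length (pairs m) ≡ m C 2
  length-pairs zero    = refl
  length-pairs (suc m) = begin
    length (pairs m ++ map (_, m) (upTo m))   ≡⟨ length-++ (pairs m) ⟩
    length (pairs m) + length (map (_, m) (upTo m))
      ≡⟨ cong₂ _+_ (length-pairs m) (trans (length-map (_, m) (upTo m)) (length-upTo m)) ⟩
    m C 2 + m                                 ≡⟨ +-comm (m C 2) m ⟩
    m + m C 2                                 ≡⟨ cong (_+ m C 2) (nC1≡n m) ⟨
    m C 1 + m C 2                             ≡⟨ nCk+nC[k+1]≡[n+1]C[k+1] m 1 ⟩
    suc m C 2                                 ∎
    where open ≡-Reasoning

  triples : ℕ → List (ℕ × ℕ × ℕ)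
  triples zero    = []
  triples (suc m) = triples m ++ map (λ (p , q) → p , q , m) (pairs m)

  ∈-triples⁻ : ∀ {m p q r} → (p , q , r) ∈ triples m → p < q × q < r × r < m
  ∈-triples⁻ {suc m} t∈ with ∈-++⁻ (triples m) t∈
  ... | inj₁ old = let p<q , q<r , r<m = ∈-triples⁻ old in p<q , q<r , m<n⇒m<1+n r<m
  ... | inj₂ new with _ , pq∈ , refl ← ∈-map⁻ _ new =
    let p<q , q<m = ∈-pairs⁻ pq∈ in p<q , q<m , n<1+n m

  ∈-triples⁺ : ∀ {m p q r} → p < q → q < r → r < m → (p , q , r) ∈ triples m
  ∈-triples⁺ {suc m} p<q q<r r<1+m with m≤n⇒m<n∨m≡n (s≤s⁻¹ r<1+m)
  ... | inj₁ r<m  = ∈-++⁺ˡ (∈-triples⁺ p<q q<r r<m)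
  ... | inj₂ refl = ∈-++⁺ʳ (triples m) (∈-map⁺ (λ (p , q) → p , q , m) (∈-pairs⁺ p<q q<r))

  triples-Unique : ∀ m → Unique (triples m)
  triples-Unique zero    = []
  triples-Unique (suc m) =
    Unique-++-separated (λ (_ , _ , r) → r) m (triples-Unique m)
      (Unique.map⁺ (λ { refl → refl }) (pairs-Unique m))
      (λ t∈ → proj₂ (proj₂ (∈-triples⁻ t∈)))
      (λ t∈ → case ∈-map⁻ _ t∈ of λ { (_ , _ , refl) → ≤-refl })

  length-triples : ∀ m → length (triples m) ≡ m C 3
  length-triples zero    = refl
  length-triples (suc m) = begin
    length (triples m ++ map _ (pairs m))          ≡⟨ length-++ (triples m) ⟩
    length (triples m) + length (map _ (pairs m))
      ≡⟨ cong₂ _+_ (length-triples m) (trans (length-map _ (pairs m)) (length-pairs m)) ⟩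
    m C 3 + m C 2                                   ≡⟨ +-comm (m C 3) (m C 2) ⟩
    m C 2 + m C 3                                   ≡⟨ nCk+nC[k+1]≡[n+1]C[k+1] m 2 ⟩
    suc m C 3                                       ∎
    where open ≡-Reasoning

  C2-identity : ∀ m → 2 * (m C 2) + m ≡ m * m
  C2-identity zero    = refl
  C2-identity (suc m) = begin
    2 * (suc m C 2) + suc m       ≡⟨ cong (λ c → 2 * c + suc m) (nCk+nC[k+1]≡[n+1]C[k+1] m 1) ⟨
    2 * (m C 1 + m C 2) + suc m   ≡⟨ cong (λ c → 2 * (c + m C 2) + suc m) (nC1≡n m) ⟩
    2 * (m + m C 2) + suc m       ≡⟨ expand m (m C 2) ⟩
    (2 * (m C 2) + m) + (2 * m + 1) ≡⟨ cong (_+ (2 * m + 1)) (C2-identity m) ⟩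
    m * m + (2 * m + 1)           ≡⟨ square m ⟩
    suc m * suc m                 ∎
    where
    open ≡-Reasoning
    expand : ∀ m c → 2 * (m + c) + suc m ≡ (2 * c + m) + (2 * m + 1)
    expand = solve-∀
    square : ∀ m → m * m + (2 * m + 1) ≡ suc m * suc m
    square = solve-∀

  C3-identity : ∀ m → 6 * (m C 3) + 3 * (m * m) ≡ m * m * m + 2 * m
  C3-identity zero    = refl
  C3-identity (suc m) = begin
    6 * (suc m C 3) + 3 * (suc m * suc m)
      ≡⟨ cong (λ c → 6 * c + 3 * (suc m * suc m)) (nCk+nC[k+1]≡[n+1]C[k+1] m 2) ⟨
    6 * (m C 2 + m C 3) + 3 * (suc m * suc m)
      ≡⟨ expand m (m C 2) (m C 3) ⟩
    (6 * (m C 3) + 3 * (m * m)) + 3 * (2 * (m C 2) + m) + (3 * m + 3)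
      ≡⟨ cong₂ (λ a b → a + 3 * b + (3 * m + 3)) (C3-identity m) (C2-identity m) ⟩
    (m * m * m + 2 * m) + 3 * (m * m) + (3 * m + 3)
      ≡⟨ cube m ⟩
    suc m * suc m * suc m + 2 * suc m ∎
    where
    open ≡-Reasoning
    expand : ∀ m a b → 6 * (a + b) + 3 * (suc m * suc m) ≡ (6 * b + 3 * (m * m)) + 3 * (2 * a + m) + (3 * m + 3)
    expand = solve-∀
    cube : ∀ m → (m * m * m + 2 * m) + 3 * (m * m) + (3 * m + 3) ≡ suc m * suc m * suc m + 2 * suc m
    cube = solve-∀

  SameBlock : ℕ → ℕ → Set
  SameBlock b c = Σ[ j ∈ ℕ ] 2 ^ j ≤ b × b < c × c < 2 ^ suc j

  block-unique : ∀ {c i j} → 2 ^ i ≤ c → c < 2 ^ suc i → 2 ^ j ≤ c → c < 2 ^ suc j → i ≡ j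
  block-unique {c} {i} {j} 2^i≤c c<2^i 2^j≤c c<2^j with <-cmp i j
  ... | tri< i<j _ _ = ⊥-elim (<⇒≱ c<2^i (≤-trans (^-monoʳ-≤ 2 i<j) 2^j≤c))
  ... | tri≈ _ i≡j _ = i≡j
  ... | tri> _ _ j<i = ⊥-elim (<⇒≱ c<2^j (≤-trans (^-monoʳ-≤ 2 j<i) 2^i≤c))

  shift₂ : ℕ → ℕ × ℕ → ℕ × ℕ
  shift₂ m (p , q) = m + p , m + q

  shift₃ : ℕ → ℕ × ℕ × ℕ → ℕ × ℕ × ℕ
  shift₃ m (p , q , r) = m + p , m + q , m + r

  blockPairs : ℕ → List (ℕ × ℕ)
  blockPairs zero    = []
  blockPairs (suc k) = blockPairs k ++ map (shift₂ (2 ^ k)) (pairs (2 ^ k))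

  ∈-blockPairs⁻ : ∀ {k b c} → (b , c) ∈ blockPairs k → SameBlock b c × c < 2 ^ k
  ∈-blockPairs⁻ {suc k} bc∈ with ∈-++⁻ (blockPairs k) bc∈
  ... | inj₁ old = let sb , c<2^k = ∈-blockPairs⁻ {k} old in sb , <-≤-trans c<2^k (^-monoʳ-≤ 2 (n≤1+n k))
  ... | inj₂ new with (p , q) , pq∈ , refl ← ∈-map⁻ _ new =
    let p<q , q<2^k = ∈-pairs⁻ pq∈ ; c< = shift-< (2 ^ k) q<2^k in
    (k , m≤m+n (2 ^ k) p , +-monoʳ-< (2 ^ k) p<q , c<) , c<

  ∈-blockPairs⁺ : ∀ {k b c} → SameBlock b c → c < 2 ^ k → (b , c) ∈ blockPairs k
  ∈-blockPairs⁺ {zero}  (_ , _ , () , _) (s≤s z≤n)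
  ∈-blockPairs⁺ {suc k} {b} {c} sb@(j , 2^j≤b , b<c , c<2^j) c<2^k with c <? 2 ^ k
  ... | yes c<  = ∈-++⁺ˡ (∈-blockPairs⁺ {k} sb c<)
  ... | no  c≮ with refl ← block-unique {c} {j} {k} (≤-trans 2^j≤b (<⇒≤ b<c)) c<2^j (≮⇒≥ c≮) c<2^k =
    ∈-++⁺ʳ (blockPairs k) (subst (_∈ _) shifted (∈-map⁺ (shift₂ (2 ^ k)) (∈-pairs⁺ low lowc)))
    where
    c≥ : 2 ^ k ≤ c
    c≥ = ≮⇒≥ c≮
    low : b ∸ 2 ^ k < c ∸ 2 ^ k
    low = ∸-monoˡ-< b<c 2^j≤b
    lowc : c ∸ 2 ^ k < 2 ^ k
    lowc = unshift-< (2 ^ k) c≥ c<2^k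
    shifted : shift₂ (2 ^ k) (b ∸ 2 ^ k , c ∸ 2 ^ k) ≡ (b , c)
    shifted = cong₂ _,_ (m+[n∸m]≡n 2^j≤b) (m+[n∸m]≡n c≥)

  blockPairs-Unique : ∀ k → Unique (blockPairs k)
  blockPairs-Unique zero    = []
  blockPairs-Unique (suc k) =
    Unique-++-separated proj₂ (2 ^ k) (blockPairs-Unique k)
      (Unique.map⁺ shift₂-injective (pairs-Unique (2 ^ k)))
      (λ bc∈ → proj₂ (∈-blockPairs⁻ {k} bc∈))
      (λ bc∈ → case ∈-map⁻ _ bc∈ of λ { (_ , _ , refl) → m≤m+n (2 ^ k) _ })
    where
    shift₂-injective : ∀ {pq pq′} → shift₂ (2 ^ k) pq ≡ shift₂ (2 ^ k) pq′ → pq ≡ pq′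
    shift₂-injective {p , q} {p′ , q′} eq =
      cong₂ _,_ (+-cancelˡ-≡ (2 ^ k) p p′ (cong proj₁ eq)) (+-cancelˡ-≡ (2 ^ k) q q′ (cong proj₂ eq))

  length-blockPairs : ∀ k → 6 * length (blockPairs k) + 3 * 2 ^ k ≡ 2 ^ k * 2 ^ k + 2
  length-blockPairs zero    = refl
  length-blockPairs (suc k) = begin
    6 * length (blockPairs k ++ map (shift₂ m) (pairs m)) + 3 * (2 * m)
      ≡⟨ cong (λ l → 6 * l + 3 * (2 * m)) lengthEq ⟩
    6 * (L + m C 2) + 3 * (2 * m)                  ≡⟨ expand L (m C 2) m ⟩
    (6 * L + 3 * m) + 3 * (2 * (m C 2) + m)
      ≡⟨ cong₂ (λ a b → a + 3 * b) (length-blockPairs k) (C2-identity m) ⟩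
    (m * m + 2) + 3 * (m * m)                      ≡⟨ square m ⟩
    (2 * m) * (2 * m) + 2                          ∎
    where
    open ≡-Reasoning
    m L : ℕ
    m = 2 ^ k
    L = length (blockPairs k)
    lengthEq : length (blockPairs k ++ map (shift₂ m) (pairs m)) ≡ L + m C 2
    lengthEq = trans (length-++ (blockPairs k)) (cong (L +_) (trans (length-map _ (pairs m)) (length-pairs m)))
    expand : ∀ L c m → 6 * (L + c) + 3 * (2 * m) ≡ (6 * L + 3 * m) + 3 * (2 * c + m)
    expand = solve-∀
    square : ∀ m → (m * m + 2) + 3 * (m * m) ≡ (2 * m) * (2 * m) + 2
    square = solve-∀

  -- The apexes x in a new block [2^k, 2^(k+1)) come with the
  -- pairs below 2^k (cross triples) and with the pairs c < x inside the block (top triples).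
  withApex : ℕ × ℕ → ℕ → ℕ × ℕ × ℕ
  withApex (b , c) x = b , c , x

  upperHalf : ℕ → List ℕ
  upperHalf k = map (2 ^ k +_) (upTo (2 ^ k))

  crossTriples : ℕ → List (ℕ × ℕ × ℕ)
  crossTriples k = cartesianProductWith withApex (blockPairs k) (upperHalf k)

  topTriples : ℕ → List (ℕ × ℕ × ℕ)
  topTriples k = map (shift₃ (2 ^ k)) (triples (2 ^ k))

  apexTriples : ℕ → List (ℕ × ℕ × ℕ)
  apexTriples zero    = []
  apexTriples (suc k) = apexTriples k ++ (crossTriples k ++ topTriples k)

  ∈-crossTriples⁻ : ∀ {k b c x} → (b , c , x) ∈ crossTriples k →
                    SameBlock b c × c < 2 ^ k × 2 ^ k ≤ x × x < 2 ^ suc k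
  ∈-crossTriples⁻ {k} t∈
    with _ , _ , bc∈ , x∈ , refl ← ∈-cartesianProductWith⁻ _ (blockPairs k) _ t∈
    with y , y∈ , refl ← ∈-map⁻ (2 ^ k +_) x∈ =
    let sb , c<2^k = ∈-blockPairs⁻ {k} bc∈ in
    sb , c<2^k , m≤m+n (2 ^ k) y , shift-< (2 ^ k) (∈-upTo⁻ y∈)

  ∈-topTriples⁻ : ∀ {k b c x} → (b , c , x) ∈ topTriples k →
                  SameBlock b c × 2 ^ k ≤ c × c < x × x < 2 ^ suc k
  ∈-topTriples⁻ {k} t∈ with (p , q , r) , pqr∈ , refl ← ∈-map⁻ (shift₃ (2 ^ k)) t∈ =
    let p<q , q<r , r<2^k = ∈-triples⁻ pqr∈ ; m = 2 ^ k in
    (k , m≤m+n m p , +-monoʳ-< m p<q , shift-< m (<-trans q<r r<2^k)) ,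
    m≤m+n m q , +-monoʳ-< m q<r , shift-< m r<2^k

  ∈-apexTriples⁻ : ∀ {k b c x} → (b , c , x) ∈ apexTriples k → SameBlock b c × c < x × x < 2 ^ k
  ∈-apexTriples⁻ {suc k} t∈ with ∈-++⁻ (apexTriples k) t∈
  ... | inj₁ old = let sb , c<x , x<2^k = ∈-apexTriples⁻ {k} old in
                   sb , c<x , <-≤-trans x<2^k (^-monoʳ-≤ 2 (n≤1+n k))
  ... | inj₂ new with ∈-++⁻ (crossTriples k) new
  ... | inj₁ cross = let sb , c<2^k , 2^k≤x , x< = ∈-crossTriples⁻ {k} cross in sb , <-≤-trans c<2^k 2^k≤x , x<
  ... | inj₂ top   = let sb , _ , c<x , x< = ∈-topTriples⁻ {k} top in sb , c<x , x<

  ∈-apexTriples⁺ : ∀ {k b c x} → SameBlock b c → c < x → x < 2 ^ k → (b , c , x) ∈ apexTriples k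
  ∈-apexTriples⁺ {zero}  _ c<x (s≤s z≤n) = ⊥-elim (n≮0 c<x)
  ∈-apexTriples⁺ {suc k} {b} {c} {x} sb@(j , 2^j≤b , b<c , c<2^j) c<x x<2^k with x <? 2 ^ k | c <? 2 ^ k
  ... | yes x<  | _      = ∈-++⁺ˡ (∈-apexTriples⁺ {k} sb c<x x<)
  ... | no  x≮ | yes c< = ∈-++⁺ʳ (apexTriples k) (∈-++⁺ˡ
    (∈-cartesianProductWith⁺ withApex (∈-blockPairs⁺ {k} sb c<)
      (subst (_∈ upperHalf k) (m+[n∸m]≡n (≮⇒≥ x≮))
        (∈-map⁺ (2 ^ k +_) (∈-upTo⁺ (unshift-< (2 ^ k) (≮⇒≥ x≮) x<2^k))))))
  ... | no  x≮ | no  c≮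
    with refl ← block-unique {c} {j} {k} (≤-trans 2^j≤b (<⇒≤ b<c)) c<2^j (≮⇒≥ c≮) (<-trans c<x x<2^k) =
    ∈-++⁺ʳ (apexTriples k) (∈-++⁺ʳ (crossTriples k)
      (subst (_∈ _) shifted (∈-map⁺ (shift₃ m) (∈-triples⁺ low mid high))))
    where
    m : ℕ
    m = 2 ^ k
    c≥ : m ≤ c
    c≥ = ≮⇒≥ c≮
    x≥ : m ≤ x
    x≥ = ≮⇒≥ x≮
    low : b ∸ m < c ∸ m
    low = ∸-monoˡ-< b<c 2^j≤b
    mid : c ∸ m < x ∸ m
    mid = ∸-monoˡ-< c<x c≥
    high : x ∸ m < m
    high = unshift-< m x≥ x<2^k
    shifted : shift₃ m (b ∸ m , c ∸ m , x ∸ m) ≡ (b , c , x)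
    shifted = cong₂ _,_ (m+[n∸m]≡n 2^j≤b) (cong₂ _,_ (m+[n∸m]≡n c≥) (m+[n∸m]≡n x≥))

  apexTriples-Unique : ∀ k → Unique (apexTriples k)
  apexTriples-Unique zero    = []
  apexTriples-Unique (suc k) =
    Unique-++-separated apex (2 ^ k) (apexTriples-Unique k)
      (Unique-++-separated core (2 ^ k) crossUnique topUnique
        (λ t∈ → proj₁ (proj₂ (∈-crossTriples⁻ {k} t∈)))
        (λ t∈ → proj₁ (proj₂ (∈-topTriples⁻ {k} t∈))))
      (λ t∈ → proj₂ (proj₂ (∈-apexTriples⁻ {k} t∈)))
      newAbove
    where
    m : ℕ
    m = 2 ^ k
    apex core : ℕ × ℕ × ℕ → ℕ
    apex (_ , _ , x) = x
    core (_ , c , _) = c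
    withApex-injective : ∀ {bc bc′ x x′} → withApex bc x ≡ withApex bc′ x′ → bc ≡ bc′ × x ≡ x′
    withApex-injective refl = refl , refl
    crossUnique : Unique (crossTriples k)
    crossUnique = UniqueS.cartesianProductWith⁺ (setoid _) (setoid _) (setoid _) withApex withApex-injective
      (blockPairs-Unique k) (Unique.map⁺ (+-cancelˡ-≡ m _ _) (Unique.upTo⁺ m))
    shift₃-injective : ∀ {t t′} → shift₃ m t ≡ shift₃ m t′ → t ≡ t′
    shift₃-injective {p , q , r} {p′ , q′ , r′} eq =
      cong₂ _,_ (+-cancelˡ-≡ m p p′ (cong proj₁ eq))
        (cong₂ _,_ (+-cancelˡ-≡ m q q′ (cong (proj₁ ∘ proj₂) eq)) (+-cancelˡ-≡ m r r′ (cong (proj₂ ∘ proj₂) eq)))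
    topUnique : Unique (topTriples k)
    topUnique = Unique.map⁺ shift₃-injective (triples-Unique m)
    newAbove : ∀ {t} → t ∈ crossTriples k ++ topTriples k → m ≤ apex t
    newAbove {b , c , x} t∈ with ∈-++⁻ (crossTriples k) t∈
    ... | inj₁ cross = proj₁ (proj₂ (proj₂ (∈-crossTriples⁻ {k} cross)))
    ... | inj₂ top   = let _ , m≤c , c<x , _ = ∈-topTriples⁻ {k} top in ≤-trans m≤c (<⇒≤ c<x)

  length-apexTriples : ∀ k → 21 * length (apexTriples k) + 7 * (2 ^ k * 2 ^ k) + 8
                            ≡ 2 ^ k * 2 ^ k * 2 ^ k + 14 * 2 ^ k
  length-apexTriples zero    = refl
  length-apexTriples (suc k) = *-cancelˡ-≡ _ _ 2 (begin
    2 * (21 * length (apexTriples (suc k)) + 7 * ((2 * m) * (2 * m)) + 8)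
      ≡⟨ cong (λ l → 2 * (21 * l + 7 * ((2 * m) * (2 * m)) + 8)) lengthEq ⟩
    2 * (21 * (L + (P * m + T)) + 7 * ((2 * m) * (2 * m)) + 8)
      ≡⟨ expand L P T m ⟩
    2 * (21 * L + 7 * (m * m) + 8) + 7 * m * (6 * P + 3 * m) + 7 * (6 * T + 3 * (m * m))
      ≡⟨ cong₂ _+_ (cong₂ (λ a b → 2 * a + 7 * m * b) (length-apexTriples k) (length-blockPairs k))
                   (cong (7 *_) (C3-identity m)) ⟩
    2 * (m * m * m + 14 * m) + 7 * m * (m * m + 2) + 7 * (m * m * m + 2 * m)
      ≡⟨ collect m ⟩
    2 * ((2 * m) * (2 * m) * (2 * m) + 14 * (2 * m)) ∎)
    where
    open ≡-Reasoning
    m L P T : ℕ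
    m = 2 ^ k
    L = length (apexTriples k)
    P = length (blockPairs k)
    T = m C 3
    lengthEq : length (apexTriples (suc k)) ≡ L + (P * m + T)
    lengthEq = trans (length-++ (apexTriples k)) (cong (L +_) (trans (length-++ (crossTriples k))
      (cong₂ _+_ (trans (length-cartesianProductWith withApex (blockPairs k) (upperHalf k))
                        (cong (P *_) (trans (length-map _ (upTo m)) (length-upTo m))))
                 (trans (length-map _ (triples m)) (length-triples m)))))
    expand : ∀ L P T m → 2 * (21 * (L + (P * m + T)) + 7 * ((2 * m) * (2 * m)) + 8)
                       ≡ 2 * (21 * L + 7 * (m * m) + 8) + 7 * m * (6 * P + 3 * m) + 7 * (6 * T + 3 * (m * m))
    expand = solve-∀
    collect : ∀ m → 2 * (m * m * m + 14 * m) + 7 * m * (m * m + 2) + 7 * (m * m * m + 2 * m)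
                  ≡ 2 * ((2 * m) * (2 * m) * (2 * m) + 14 * (2 * m))
    collect = solve-∀

  dyadic-block : ∀ k {U} → 1 ≤ U → U < 2 ^ k → Σ[ j ∈ ℕ ] j < k × 2 ^ j ≤ U × U < 2 ^ suc j
  dyadic-block zero    {suc _} _ (s≤s ())
  dyadic-block (suc k) {U} 1≤U U<2^k with U <? 2 ^ k
  ... | yes U<  = let j , j<k , lower , upper = dyadic-block k 1≤U U< in j , m<n⇒m<1+n j<k , lower , upper
  ... | no  U≮ = k , n<1+n k , ≮⇒≥ U≮ , U<2^k

module Apex (k : ℕ) (3≤k : 3 ≤ k) where

  open import Data.Nat
  open import Data.Nat.Properties
  open import Data.Nat.DivMod using (_mod_; m<n⇒m%n≡m)
  open import Data.Fin using (Fin; toℕ)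
  open import Data.Fin.Properties using (toℕ-injective; toℕ<n; toℕ-fromℕ<)
  open import Data.Fin.Subset using (Subset; ∣_∣) renaming (_∈_ to _∈ₛ_)
  open import Data.List using (List; []; _∷_; map; length; foldr)
  open import Data.List.Properties using (∷-injectiveʳ)
  open import Data.List.Membership.Propositional using (_∈_)
  open import Data.List.Membership.Propositional.Properties using (∈-map⁺; ∈-map⁻; ∈-++⁺ˡ)
  open import Data.List.Relation.Unary.Any using (here; there)
  open import Data.List.Relation.Unary.All using (All; []; _∷_)
  import Data.List.Relation.Unary.All as All
  import Data.List.Relation.Unary.All.Properties as Allₚ
  open import Data.List.Relation.Unary.AllPairs using (AllPairs; []; _∷_)
  import Data.List.Relation.Unary.AllPairs as AllPairs
  open import Data.List.Relation.Unary.Unique.Propositional using (Unique)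
  import Data.List.Relation.Unary.Unique.Propositional.Properties as Unique
  open import Data.Maybe.Properties using (just-injective)
  open import Data.Product using (_×_; _,_; proj₁; proj₂; Σ-syntax; ∃-syntax)
  open import Data.Empty using (⊥; ⊥-elim)
  open import Relation.Nullary using (yes; no)
  open import Relation.Binary.Definitions using (tri<; tri≈; tri>)
  open import Relation.Binary.PropositionalEquality
  open import Defs
    using (toSub; Hypergraph; edges; windowSets; SemicycleFree; IsChainSeq; chainLength; ChainConnected; Is2Hypertree)
  open Xor
  open FinSet
  open Lists using (Unique-map-on; increasing-ext)
  open Enumeration

  private
    _⊕_ : ℕ → ℕ → ℕ
    _⊕_ = bxor k

  -- Vertices are Fin N with N = 2^k − 1; vertex i stands for the nonzero k-bit number
  -- val i = i + 1, and toV y is the vertex of a number y ∈ [1, 2^k).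
  N : ℕ
  N = pred (2 ^ k)

  -- N ≠ 0 (so that toV can reduce modulo N), and N + 1 = 2^k.
  instance
    N-nonZero : NonZero N
    N-nonZero = >-nonZero (pred-mono-≤ (^-monoʳ-≤ 2 {1} {k} (≤-trans (s≤s z≤n) 3≤k)))

  suc-N : suc N ≡ 2 ^ k
  suc-N = suc-pred (2 ^ k) {{m^n≢0 2 k}}

  val : Fin N → ℕ
  val i = suc (toℕ i)

  toV : ℕ → Fin N
  toV y = pred y mod N

  InRange : ℕ → Set
  InRange y = 1 ≤ y × y < 2 ^ k

  val-inRange : ∀ i → InRange (val i)
  val-inRange i = s≤s z≤n , subst (val i <_) suc-N (s≤s (toℕ<n i))

  val-injective : ∀ {i j} → val i ≡ val j → i ≡ j
  val-injective eq = toℕ-injective (suc-injective eq)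

  val-toV : ∀ {y} → InRange y → val (toV y) ≡ y
  val-toV {suc y} (_ , y<2^k) = cong suc (trans (toℕ-fromℕ< _) (m<n⇒m%n≡m y<N))
    where
    y<N : y < N
    y<N = s≤s⁻¹ (subst (suc y <_) (sym suc-N) y<2^k)

  toV-val : ∀ i → toV (val i) ≡ i
  toV-val i = val-injective (val-toV (val-inRange i))

  -- The edge of a triple t = (b, c, x) consists of the line {b ⊕ c, b, c} of F₂^k
  -- and the apex x above it.
  quad : ℕ × ℕ × ℕ → List ℕ
  quad (b , c , x) = b ⊕ c ∷ b ∷ c ∷ x ∷ []

  apex : ℕ × ℕ × ℕ → ℕ
  apex (_ , _ , x) = x

  Triples : List (ℕ × ℕ × ℕ)
  Triples = apexTriples k

  record Increasing (b c x : ℕ) : Set where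
    field
      line<  : b ⊕ c < b
      b<c    : b < c
      c<x    : c < x
      x<2^k  : x < 2 ^ k
      line≥1 : 1 ≤ b ⊕ c

  increasing : ∀ {b c x} → (b , c , x) ∈ Triples → Increasing b c x
  increasing {b} {c} {x} t∈ with (j , 2^j≤b , b<c , c<2^j) , c<x , x<2^k ← ∈-apexTriples⁻ {k} t∈ =
    record
      { line< = <-≤-trans (bxor-block j k 2^j≤b (<-trans b<c c<2^j) 2^j≤c c<2^j) 2^j≤b
      ; b<c = b<c ; c<x = c<x ; x<2^k = x<2^k
      ; line≥1 = n≢0⇒n>0 λ b⊕c≡0 → <⇒≢ b<c (bxor≡0⇒≡ k b<2^k c<2^k b⊕c≡0) }
    where
    2^j≤c : 2 ^ j ≤ c
    2^j≤c = ≤-trans 2^j≤b (<⇒≤ b<c)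
    c<2^k : c < 2 ^ k
    c<2^k = <-trans c<x x<2^k
    b<2^k : b < 2 ^ k
    b<2^k = <-trans b<c c<2^k

  quad-increasing : ∀ {t} → t ∈ Triples → AllPairs _<_ (quad t)
  quad-increasing t∈ =
    (g<b ∷ <-trans g<b b<c ∷ <-trans (<-trans g<b b<c) c<x ∷ []) ∷
    (b<c ∷ <-trans b<c c<x ∷ []) ∷ (c<x ∷ []) ∷ [] ∷ []
    where open Increasing (increasing t∈) renaming (line< to g<b)

  ≤-apex : ∀ {t y} → t ∈ Triples → y ∈ quad t → y ≤ apex t
  ≤-apex t∈ (here refl)                         = <⇒≤ (<-trans (<-trans line< b<c) c<x)
    where open Increasing (increasing t∈)
  ≤-apex t∈ (there (here refl))                 = <⇒≤ (<-trans b<c c<x)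
    where open Increasing (increasing t∈)
  ≤-apex t∈ (there (there (here refl)))         = <⇒≤ (Increasing.c<x (increasing t∈))
  ≤-apex t∈ (there (there (there (here refl)))) = ≤-refl

  line≤ : ∀ {b c x y} → (b , c , x) ∈ Triples → y ∈ quad (b , c , x) → b ⊕ c ≤ y
  line≤ t∈ (here refl)                         = ≤-refl
  line≤ t∈ (there (here refl))                 = <⇒≤ (Increasing.line< (increasing t∈))
  line≤ t∈ (there (there (here refl)))         = <⇒≤ (<-trans line< b<c)
    where open Increasing (increasing t∈)
  line≤ t∈ (there (there (there (here refl)))) = <⇒≤ (<-trans (<-trans line< b<c) c<x)
    where open Increasing (increasing t∈)

  quad-inRange : ∀ {t} → t ∈ Triples → All InRange (quad t)
  quad-inRange t∈ = All.tabulate λ y∈ →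
    ≤-trans line≥1 (line≤ t∈ y∈) , ≤-<-trans (≤-apex t∈ y∈) x<2^k
    where open Increasing (increasing t∈)

  vertices : ℕ × ℕ × ℕ → List (Fin N)
  vertices t = map toV (quad t)

  edge : ℕ × ℕ × ℕ → Subset N
  edge t = toSub (vertices t)

  map-val-toV : ∀ {ys} → All InRange ys → map val (map toV ys) ≡ ys
  map-val-toV []       = refl
  map-val-toV (r ∷ rs) = cong₂ _∷_ (val-toV r) (map-val-toV rs)

  val-vertices : ∀ {t} → t ∈ Triples → map val (vertices t) ≡ quad t
  val-vertices t∈ = map-val-toV (quad-inRange t∈)

  ∈-edge⁻ : ∀ {t i} → t ∈ Triples → i ∈ₛ edge t → val i ∈ quad t
  ∈-edge⁻ {t} {i} t∈ i∈ = subst (val i ∈_) (val-vertices t∈) (∈-map⁺ val (∈-toSub⁻ (vertices t) i∈))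

  ∈-vertices : ∀ {t i} → val i ∈ quad t → i ∈ vertices t
  ∈-vertices {t} {i} y∈ = subst (_∈ vertices t) (toV-val i) (∈-map⁺ toV y∈)

  ∈-edge⁺ : ∀ {t i} → val i ∈ quad t → i ∈ₛ edge t
  ∈-edge⁺ {t} y∈ = ∈-toSub⁺ (∈-vertices {t} y∈)

  vertices-Unique : ∀ {t} → t ∈ Triples → Unique (vertices t)
  vertices-Unique {t} t∈ = Unique.map⁻ {f = val} {xs = vertices t} (subst Unique (sym (val-vertices t∈))
    (AllPairs.map (λ y<z → <⇒≢ y<z) (quad-increasing t∈)))

  ∣edge∣≡4 : ∀ {t} → t ∈ Triples → ∣ edge t ∣ ≡ 4
  ∣edge∣≡4 t∈ = Unique⇒∣toSub∣≡length (vertices-Unique t∈)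

  window-Unique : ∀ {t} (ws : List (Fin N)) → t ∈ Triples → toSub ws ≡ edge t → length ws ≡ 4 → Unique ws
  window-Unique ws t∈ eq |ws|≡4 =
    ∣toSub∣≡length⇒Unique ws (trans (cong ∣_∣ eq) (trans (∣edge∣≡4 t∈) (sym |ws|≡4)))

  apexVertex : ℕ × ℕ × ℕ → Fin N
  apexVertex t = toV (apex t)

  apex∈quad : ∀ t → apex t ∈ quad t
  apex∈quad (b , c , x) = there (there (there (here refl)))

  val-apexVertex : ∀ {t} → t ∈ Triples → val (apexVertex t) ≡ apex t
  val-apexVertex {t} t∈ = val-toV (All.lookup (quad-inRange t∈) (apex∈quad t))

  apexVertex-∈ : ∀ {t} → t ∈ Triples → apexVertex t ∈ₛ edge t
  apexVertex-∈ {t} t∈ = ∈-edge⁺ {t} (subst (_∈ quad t) (sym (val-apexVertex t∈)) (apex∈quad t))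

  open SubsetFold _⊕_ 0 (bxor-comm k) (bxor-assoc k)

  -- The ⊕-sum of the numbers of the vertices of an edge is its apex, since the
  -- three points of a line sum to zero.
  ⨁-edge : ∀ {t} → t ∈ Triples → ⨁ val (edge t) ≡ apex t
  ⨁-edge {t@(b , c , x)} t∈ = begin
    ⨁ val (toSub (vertices t))              ≡⟨ ⨁-toSub val (vertices-Unique t∈) ⟩
    foldr _⊕_ 0 (map val (vertices t))      ≡⟨ cong (foldr _⊕_ 0) (val-vertices t∈) ⟩
    (b ⊕ c) ⊕ (b ⊕ (c ⊕ (x ⊕ 0)))          ≡⟨ cong (λ y → (b ⊕ c) ⊕ (b ⊕ (c ⊕ y))) (bxor-identityʳ k x<2^k) ⟩
    (b ⊕ c) ⊕ (b ⊕ (c ⊕ x))                ≡⟨ cong ((b ⊕ c) ⊕_) (bxor-assoc k b c x) ⟨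
    (b ⊕ c) ⊕ ((b ⊕ c) ⊕ x)                ≡⟨ bxor-cancelˡ k (b ⊕ c) x<2^k ⟩
    x                                      ∎
    where
    open ≡-Reasoning
    open Increasing (increasing t∈)

  foldr-⊕-< : ∀ ys → foldr _⊕_ 0 ys < 2 ^ k
  foldr-⊕-< []       = m^n>0 2 k
  foldr-⊕-< (y ∷ ys) = bxor-< k y (foldr _⊕_ 0 ys)

  module _ (S : List (Fin N)) (|S|≡3 : length S ≡ 3) where

    private
      σ : ℕ
      σ = foldr _⊕_ 0 (map val S)

      val<2^k : ∀ i → val i < 2 ^ k
      val<2^k i = proj₂ (val-inRange i)

      sum : ∀ {r u} → u ∈ Triples → toSub (r ∷ S) ≡ edge u → apex u ≡ val r ⊕ σ
      sum {r} {u} u∈ eq = begin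
        apex u                     ≡⟨ ⨁-edge u∈ ⟨
        ⨁ val (edge u)             ≡⟨ cong (⨁ val) eq ⟨
        ⨁ val (toSub (r ∷ S))      ≡⟨ ⨁-toSub val (window-Unique (r ∷ S) u∈ eq (cong suc |S|≡3)) ⟩
        val r ⊕ σ                  ∎
        where open ≡-Reasoning

      position : ∀ {r u} → u ∈ Triples → toSub (r ∷ S) ≡ edge u → apexVertex u ∈ r ∷ S
      position {r} {u} u∈ eq = ∈-toSub⁻ (r ∷ S) (subst (apexVertex u ∈ₛ_) (sym eq) (apexVertex-∈ u∈))

      bounded : ∀ {r u i} → u ∈ Triples → toSub (r ∷ S) ≡ edge u → i ∈ S → val i ≤ apex u
      bounded {r} {u} {i} u∈ eq i∈S = ≤-apex u∈ (∈-edge⁻ u∈ (subst (i ∈ₛ_) eq (∈-toSub⁺ (there i∈S))))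

    -- With σ the ⊕-sum of S the apexes are val p ⊕ σ and val q ⊕ σ; if the
    -- first apex lay in S it would be at most the second, which then cannot lie in S as
    -- well (the apexes would coincide, forcing p = q) and so is q, giving σ = 0.
    apex-private : ∀ {t t′ p q} → t ∈ Triples → t′ ∈ Triples →
                   toSub (p ∷ S) ≡ edge t → toSub (q ∷ S) ≡ edge t′ → edge t ≢ edge t′ →
                   val p ≡ apex t
    apex-private {t} {t′} {p} {q} t∈ t′∈ e e′ e≢e′ with position t∈ e
    ... | here a≡p = trans (cong val (sym a≡p)) (val-apexVertex t∈)
    ... | there a∈S with position t′∈ e′
    ...   | here a′≡q = begin
            val p        ≡⟨ bxor-identityʳ k (val<2^k p) ⟨
            val p ⊕ 0    ≡⟨ cong (val p ⊕_) σ≡0 ⟨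
            val p ⊕ σ    ≡⟨ sum t∈ e ⟨
            apex t       ∎
      where
      open ≡-Reasoning
      q⊕σ≡q : val q ⊕ σ ≡ val q
      q⊕σ≡q = trans (sym (sum t′∈ e′)) (trans (sym (val-apexVertex t′∈)) (cong val a′≡q))
      σ≡0 : σ ≡ 0
      σ≡0 = bxor-injectiveˡ k (val q) (foldr-⊕-< (map val S)) (m^n>0 2 k)
              (trans (bxor-comm k σ (val q)) (trans q⊕σ≡q (sym (bxor-identityˡ k (val<2^k q)))))
    ...   | there a′∈S = ⊥-elim (e≢e′ (trans (sym e) (trans (cong (λ r → toSub (r ∷ S)) p≡q) e′)))
      where
      apex≡ : apex t ≡ apex t′
      apex≡ = ≤-antisym (subst (_≤ apex t′) (val-apexVertex t∈) (bounded t′∈ e′ a∈S))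
                        (subst (_≤ apex t) (val-apexVertex t′∈) (bounded t∈ e a′∈S))
      p≡q : p ≡ q
      p≡q = val-injective (bxor-injectiveˡ k σ (val<2^k p) (val<2^k q)
              (trans (sym (sum t∈ e)) (trans apex≡ (sum t′∈ e′))))

  -- Distinct triples give distinct edges: an edge determines its increasing quadruple.
  quad-⊆ : ∀ {t t′ y} → t ∈ Triples → t′ ∈ Triples → edge t ≡ edge t′ → y ∈ quad t → y ∈ quad t′
  quad-⊆ {t} {t′} {y} t∈ t′∈ eq y∈ =
    subst (_∈ quad t′) y≡ (∈-edge⁻ t′∈ (subst (toV y ∈ₛ_) eq (∈-edge⁺ {t} (subst (_∈ quad t) (sym y≡) y∈))))
    where y≡ = val-toV (All.lookup (quad-inRange t∈) y∈)

  edge-injective : ∀ {t t′} → t ∈ Triples → t′ ∈ Triples → edge t ≡ edge t′ → t ≡ t′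
  edge-injective t∈ t′∈ eq
    with refl ← ∷-injectiveʳ (increasing-ext (quad-increasing t∈) (quad-increasing t′∈)
                                             (quad-⊆ t∈ t′∈ eq) (quad-⊆ t′∈ t∈ (sym eq))) = refl

  H : Hypergraph 4
  H = record
    { n        = N
    ; edges    = map edge Triples
    ; distinct = Unique-map-on edge (apexTriples-Unique k) edge-injective
    ; uniform  = Allₚ.map⁺ (All.tabulate ∣edge∣≡4) }

  -- Three consecutive windows of a vertex sequence are never three different edges:
  -- the apex of the middle edge would be both its first and its last vertex.
  no-three-windows : ∀ (a b c d e f : Fin N) rest →
                     Unique (windowSets 4 (a ∷ b ∷ c ∷ d ∷ e ∷ f ∷ rest)) →
                     All (_∈ edges H) (windowSets 4 (a ∷ b ∷ c ∷ d ∷ e ∷ f ∷ rest)) → ⊥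
  no-three-windows a b c d e f rest ((W₁≢W₂ ∷ _) ∷ (W₂≢W₃ ∷ _) ∷ _) (W₁∈ ∷ W₂∈ ∷ W₃∈ ∷ _)
    with t₁ , t₁∈ , eq₁ ← ∈-map⁻ edge W₁∈
       | t₂ , t₂∈ , eq₂ ← ∈-map⁻ edge W₂∈
       | t₃ , t₃∈ , eq₃ ← ∈-map⁻ edge W₃∈
    with b∉ ∷ _ ← window-Unique (b ∷ c ∷ d ∷ e ∷ []) t₂∈ eq₂ refl
    = All.lookup b∉ (there (there (here refl))) (val-injective (trans b-apex (sym e-apex)))
    where
    e-apex : val e ≡ apex t₂
    e-apex = apex-private (b ∷ c ∷ d ∷ []) refl t₂∈ t₁∈ (trans (sym (toSub-∷ʳ (b ∷ c ∷ d ∷ []) e)) eq₂) eq₁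
               (λ eq → W₁≢W₂ (trans eq₁ (trans (sym eq) (sym eq₂))))
    b-apex : val b ≡ apex t₂
    b-apex = apex-private (c ∷ d ∷ e ∷ []) refl t₂∈ t₃∈ eq₂ (trans (sym (toSub-∷ʳ (c ∷ d ∷ e ∷ []) f)) eq₃)
               (λ eq → W₂≢W₃ (trans eq₂ (trans eq (sym eq₃))))

  -- A semicycle would need one window (v₁ = v₄ repeats a vertex), two windows
  -- (v₁ = v₅ makes them the same edge) or at least three windows.
  semicycle-free : SemicycleFree H
  semicycle-free []                        ((() , _) , _)
  semicycle-free (_ ∷ [])                  ((() , _) , _)
  semicycle-free (_ ∷ _ ∷ [])              ((() , _) , _)
  semicycle-free (_ ∷ _ ∷ _ ∷ [])          ((() , _) , _)
  semicycle-free (a ∷ b ∷ c ∷ d ∷ [])      ((_ , _ , W∈ ∷ []) , a≡d)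
    with refl ← just-injective a≡d
    with t , t∈ , eq ← ∈-map⁻ edge W∈
    with a∉ ∷ _ ← window-Unique (a ∷ b ∷ c ∷ a ∷ []) t∈ eq refl
    = All.lookup a∉ (there (there (here refl))) refl
  semicycle-free (a ∷ b ∷ c ∷ d ∷ e ∷ [])  ((_ , (W₁≢W₂ ∷ _) ∷ _ , _) , a≡e)
    with refl ← just-injective a≡e
    = W₁≢W₂ (sym (toSub-∷ʳ (b ∷ c ∷ d ∷ []) a))
  semicycle-free (a ∷ b ∷ c ∷ d ∷ e ∷ f ∷ rest) ((_ , distinct , ⊆edges) , _) =
    no-three-windows a b c d e f rest distinct ⊆edges

  chains≤2 : ∀ vs → IsChainSeq H vs → chainLength 4 vs ≤ 2
  chains≤2 []                             _ = z≤n
  chains≤2 (_ ∷ [])                       _ = z≤n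
  chains≤2 (_ ∷ _ ∷ [])                   _ = z≤n
  chains≤2 (_ ∷ _ ∷ _ ∷ [])               _ = z≤n
  chains≤2 (_ ∷ _ ∷ _ ∷ _ ∷ [])           _ = s≤s z≤n
  chains≤2 (_ ∷ _ ∷ _ ∷ _ ∷ _ ∷ [])       _ = s≤s (s≤s z≤n)
  chains≤2 (a ∷ b ∷ c ∷ d ∷ e ∷ f ∷ rest) ((_ , distinct , ⊆edges) , _) =
    ⊥-elim (no-three-windows a b c d e f rest distinct ⊆edges)

  edge-chain : ∀ {t} → t ∈ Triples → IsChainSeq H (vertices t)
  edge-chain {t@(b , c , x)} t∈ =
    (s≤s z≤n , [] ∷ [] , ∈-map⁺ edge t∈ ∷ []) , λ g≡x → <⇒≢ g<x (begin
      b ⊕ c             ≡⟨ val-toV (All.lookup (quad-inRange t∈) (here refl)) ⟨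
      val (toV (b ⊕ c)) ≡⟨ cong val (just-injective g≡x) ⟩
      val (toV x)       ≡⟨ val-apexVertex t∈ ⟩
      x                 ∎)
    where
    open ≡-Reasoning
    open Increasing (increasing t∈)
    g<x : b ⊕ c < x
    g<x = <-trans (<-trans line< b<c) c<x

  Covered : ℕ → ℕ → Set
  Covered U V = Σ[ t ∈ ℕ × ℕ × ℕ ] t ∈ Triples × U ∈ quad t × V ∈ quad t

  Covered-sym : ∀ {U V} → Covered U V → Covered V U
  Covered-sym (t , t∈ , U∈ , V∈) = t , t∈ , V∈ , U∈

  Covered⇒chain : ∀ {u v} → Covered (val u) (val v) → ∃[ vs ] (IsChainSeq H vs × u ∈ vs × v ∈ vs)
  Covered⇒chain (t , t∈ , u∈ , v∈) = vertices t , edge-chain t∈ , ∈-vertices u∈ , ∈-vertices v∈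

  line : ℕ → ℕ → List ℕ
  line b c = b ⊕ c ∷ b ∷ c ∷ []

  line⊆quad : ∀ {b c x y} → y ∈ line b c → y ∈ quad (b , c , x)
  line⊆quad {x = x} y∈ = ∈-++⁺ˡ {ys = x ∷ []} y∈

  covered-by-apex : ∀ {b c U V} → SameBlock b c → c < V → V < 2 ^ k → U ∈ line b c → Covered U V
  covered-by-apex sb c<V V<2^k U∈ =
    _ , ∈-apexTriples⁺ {k} sb c<V V<2^k , line⊆quad U∈ , there (there (there (here refl)))

  covered-by-line : ∀ {b c U V} → SameBlock b c → c < N → U ∈ line b c → V ∈ line b c → Covered U V
  covered-by-line sb c<N U∈ V∈ =
    _ , ∈-apexTriples⁺ {k} sb c<N (subst (N <_) suc-N ≤-refl) , line⊆quad U∈ , line⊆quad V∈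

  powerPair : ∀ j → 1 ≤ j → SameBlock (2 ^ j) (suc (2 ^ j))
  powerPair j 1≤j = j , ≤-refl , n<1+n (2 ^ j) ,
    subst (_< 2 * 2 ^ j) (+-comm (2 ^ j) 1) (shift-< (2 ^ j) (^-monoʳ-≤ 2 1≤j))

  powerPair<N : ∀ {j} → j < k → suc (2 ^ j) < N
  powerPair<N {j} j<k = s≤s⁻¹ (subst (3 + 2 ^ j ≤_) (sym suc-N) (gap 3≤k j<k))
    where
    gap : ∀ {j k} → 3 ≤ k → j < k → 3 + 2 ^ j ≤ 2 ^ k
    gap {j} {suc k} (s≤s 2≤k) (s≤s j≤k) = begin
      3 + 2 ^ j        ≤⟨ +-mono-≤ (≤-trans (s≤s (s≤s (s≤s z≤n))) (^-monoʳ-≤ 2 2≤k)) (^-monoʳ-≤ 2 j≤k) ⟩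
      2 ^ k + 2 ^ k    ≡⟨ cong (2 ^ k +_) (+-identityʳ (2 ^ k)) ⟨
      2 ^ suc k        ∎
      where open ≤-Reasoning

  one∈ : 1 ∈ line 2 3
  one∈ = subst (_∈ line 2 3) (bxor-2-3 k (≤-trans (n≤1+n 2) 3≤k)) (here refl)

  two-or-three : ∀ {V} → 1 < V → V ≤ 3 → V ∈ line 2 3
  two-or-three {1} (s≤s ()) _
  two-or-three {2} _ _ = there (here refl)
  two-or-three {3} _ _ = there (there (here refl))
  two-or-three {suc (suc (suc (suc _)))} _ (s≤s (s≤s (s≤s ())))

  -- Let 2^j ≤ U < 2^(j+1).  If U is
  -- not a power of two, (2^j, U) is a block pair; otherwise U lies on the line of the
  -- pair (2^j, 2^j + 1) (of (2, 3) when U = 1, as 2 ⊕ 3 = 1).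
  cover : ∀ {U V} → 1 ≤ U → U < V → V < 2 ^ k → Covered U V
  cover {U} {V} 1≤U U<V V<2^k with dyadic-block k 1≤U (<-trans U<V V<2^k)
  ... | zero , _ , 1≤U′ , U<2 with refl ← ≤-antisym (s≤s⁻¹ U<2) 1≤U′ with 3 <? V
  ...   | yes 3<V = covered-by-apex (powerPair 1 ≤-refl) 3<V V<2^k one∈
  ...   | no  3≮V = covered-by-line (powerPair 1 ≤-refl) (powerPair<N (≤-trans (s≤s (s≤s z≤n)) 3≤k)) one∈
                      (two-or-three U<V (≮⇒≥ 3≮V))
  cover {U} {V} 1≤U U<V V<2^k | suc j , j<k , 2^j≤U , U<2^j with U ≟ 2 ^ suc j
  ... | no  U≢2^j = covered-by-apex (suc j , ≤-refl , ≤∧≢⇒< 2^j≤U (λ eq → U≢2^j (sym eq)) , U<2^j) U<V V<2^k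
                      (there (there (here refl)))
  ... | yes refl with suc (2 ^ suc j) <? V
  ...   | yes c<V = covered-by-apex (powerPair (suc j) (s≤s z≤n)) c<V V<2^k (there (here refl))
  ...   | no  c≮V with refl ← ≤-antisym (≮⇒≥ c≮V) U<V =
    covered-by-line (powerPair (suc j) (s≤s z≤n)) (powerPair<N j<k)
                    (there (here refl)) (there (there (here refl)))

  chain-connected : ChainConnected H
  chain-connected u v u≢v with <-cmp (val u) (val v)
  ... | tri< u<v _ _ = Covered⇒chain (cover (proj₁ (val-inRange u)) u<v (proj₂ (val-inRange v)))
  ... | tri≈ _ u≡v _ = ⊥-elim (u≢v (val-injective u≡v))
  ... | tri> _ _ v<u = Covered⇒chain (Covered-sym (cover (proj₁ (val-inRange v)) v<u (proj₂ (val-inRange u))))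

  is-2-hypertree : Is2Hypertree H
  is-2-hypertree = (chain-connected , semicycle-free) , chains≤2

module Counting where

  open import Data.Nat
  open import Data.Nat.Properties
  open import Data.Nat.Combinatorics using (_C_)
  open import Data.Nat.Tactic.RingSolver using (solve-∀)
  open import Data.Product using (_×_; _,_)
  open import Relation.Binary.PropositionalEquality
  open Enumeration using (C3-identity)

  edges-vs-triples : ∀ n E → 21 * E + 7 * (suc n * suc n) + 8 ≡ suc n * suc n * suc n + 14 * suc n →
                     21 * E + n * n ≡ 6 * (n C 3) + n
  edges-vs-triples n E count = +-cancelʳ-≡ R _ _ (begin
    (21 * E + n * n) + R                               ≡⟨ regroup₁ E n ⟩
    (21 * E + 7 * (suc n * suc n) + 8) + 4 * (n * n)   ≡⟨ cong (_+ 4 * (n * n)) count ⟩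
    (suc n * suc n * suc n + 14 * suc n) + 4 * (n * n) ≡⟨ regroup₂ n ⟩
    (n * n * n + 2 * n) + (n + 7 * (suc n * suc n) + 8) ≡⟨ cong (_+ (n + 7 * (suc n * suc n) + 8)) (C3-identity n) ⟨
    (6 * (n C 3) + 3 * (n * n)) + (n + 7 * (suc n * suc n) + 8) ≡⟨ regroup₃ (n C 3) n ⟩
    (6 * (n C 3) + n) + R                              ∎)
    where
    open ≡-Reasoning
    R : ℕ
    R = 7 * (suc n * suc n) + 8 + 3 * (n * n)
    regroup₁ : ∀ E n → (21 * E + n * n) + (7 * (suc n * suc n) + 8 + 3 * (n * n))
                     ≡ (21 * E + 7 * (suc n * suc n) + 8) + 4 * (n * n)
    regroup₁ = solve-∀
    regroup₂ : ∀ n → (suc n * suc n * suc n + 14 * suc n) + 4 * (n * n)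
                   ≡ (n * n * n + 2 * n) + (n + 7 * (suc n * suc n) + 8)
    regroup₂ = solve-∀
    regroup₃ : ∀ c n → (6 * c + 3 * (n * n)) + (n + 7 * (suc n * suc n) + 8)
                     ≡ (6 * c + n) + (7 * (suc n * suc n) + 8 + 3 * (n * n))
    regroup₃ = solve-∀

  -- Consequently the edges form about 2/7 of the triples: with n = m + 2 and
  -- X = n(n − 1) we get 6·C(n,3) = 21·E + X = X·m, so 7·E ≤ 2·C(n,3) with defect
  -- 3·(2·C(n,3) − 7·E) = X, which is small compared with 7·C(n,3) = 7·X·m/6.
  -- Below, T stands for C(n,3).
  module TwoSevenths (m E : ℕ) where

    private
      n T X : ℕ
      n = suc (suc m)
      T = n C 3
      X = n * suc m

    module _ (count : 21 * E + n * n ≡ 6 * T + n) where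

      private
        6T≡21E+X : 6 * T ≡ 21 * E + X
        6T≡21E+X = +-cancelʳ-≡ n _ _ (begin
          6 * T + n          ≡⟨ count ⟨
          21 * E + n * n     ≡⟨ cong (21 * E +_) (*-suc n (suc m)) ⟩
          21 * E + (n + X)   ≡⟨ swap (21 * E) n X ⟩
          21 * E + X + n     ∎)
          where
          open ≡-Reasoning
          swap : ∀ a b c → a + (b + c) ≡ a + c + b
          swap = solve-∀

        6T≡Xm : 6 * T ≡ X * m
        6T≡Xm = +-cancelʳ-≡ (3 * (n * n)) _ _ (trans (C3-identity n) (cube m))
          where
          cube : ∀ m → suc (suc m) * suc (suc m) * suc (suc m) + 2 * suc (suc m)
                     ≡ suc (suc m) * suc m * m + 3 * (suc (suc m) * suc (suc m))
          cube = solve-∀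

        3·E7 : 3 * (E * 7) ≡ 21 * E
        3·E7 = regroup E
          where
          regroup : ∀ e → 3 * (e * 7) ≡ 21 * e
          regroup = solve-∀

        3D≡X : 3 * (2 * T ∸ E * 7) ≡ X
        3D≡X = begin
          3 * (2 * T ∸ E * 7)         ≡⟨ *-distribˡ-∸ 3 (2 * T) (E * 7) ⟩
          3 * (2 * T) ∸ 3 * (E * 7)   ≡⟨ cong₂ _∸_ (trans (sym (*-assoc 3 2 T)) 6T≡21E+X) 3·E7 ⟩
          21 * E + X ∸ 21 * E         ≡⟨ m+n∸m≡n (21 * E) X ⟩
          X                           ∎
          where open ≡-Reasoning

      below : E * 7 ≤ 2 * T
      below = *-cancelˡ-≤ 3 (begin
        3 * (E * 7)      ≡⟨ 3·E7 ⟩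
        21 * E           ≤⟨ m≤m+n (21 * E) X ⟩
        21 * E + X       ≡⟨ 6T≡21E+X ⟨
        6 * T            ≡⟨ *-assoc 3 2 T ⟩
        3 * (2 * T)      ∎)
        where open ≤-Reasoning

      -- Times 6 the claim reads 2X(i + 1) < 7Xm, and 2(i + 1) ≤ 2m < 7m.
      defect : ∀ i → suc i ≤ m → (2 * T ∸ E * 7) * suc i < T * 7
      defect i i<m = *-cancelˡ-< 6 _ _ (begin-strict
        6 * (D * suc i)        ≡⟨ regroup D (suc i) ⟩
        (3 * D) * (2 * suc i)  ≡⟨ cong (_* (2 * suc i)) 3D≡X ⟩
        X * (2 * suc i)        <⟨ *-monoʳ-< X (≤-<-trans (*-monoʳ-≤ 2 i<m) 2m<7m) ⟩
        X * (7 * m)            ≡⟨ regroup′ X m ⟩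
        7 * (X * m)            ≡⟨ cong (7 *_) 6T≡Xm ⟨
        7 * (6 * T)            ≡⟨ regroup″ T ⟩
        6 * (T * 7)            ∎)
        where
        open ≤-Reasoning
        D : ℕ
        D = 2 * T ∸ E * 7
        2m<7m : 2 * m < 7 * m
        2m<7m = *-monoˡ-< m {{>-nonZero (≤-trans (s≤s z≤n) i<m)}} {2} {7} (s≤s (s≤s (s≤s z≤n)))
        regroup : ∀ d j → 6 * (d * j) ≡ (3 * d) * (2 * j)
        regroup = solve-∀
        regroup′ : ∀ x m → x * (7 * m) ≡ 7 * (x * m)
        regroup′ = solve-∀
        regroup″ : ∀ c → 7 * (6 * c) ≡ 6 * (c * 7)
        regroup″ = solve-∀

  two-sevenths : ∀ n E i → 3 + i ≤ n →
                 21 * E + 7 * (suc n * suc n) + 8 ≡ suc n * suc n * suc n + 14 * suc n →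
                 E * 7 ≤ 2 * (n C 3) × (2 * (n C 3) ∸ E * 7) * suc i < (n C 3) * 7
  two-sevenths (suc (suc m)) E i (s≤s (s≤s i<m)) count = below balance , defect balance i i<m
    where
    open TwoSevenths m E using (below; defect)
    balance : 21 * E + suc (suc m) * suc (suc m) ≡ 6 * (suc (suc m) C 3) + suc (suc m)
    balance = edges-vs-triples (suc (suc m)) E count

module Limit where

  open import Data.Nat as ℕ using (ℕ; zero; suc; NonZero; _≤_; _<_; _∸_; s≤s)
  import Data.Nat.Properties as ℕ
  open import Data.Integer as ℤ using (ℤ; +_; -[1+_]; _⊖_)
  import Data.Integer.Properties as ℤ
  open import Data.Rational using (ℚ; mkℚ; _/_; _-_; toℚᵘ) renaming (∣_∣ to abs; _<_ to _<ℚ_)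
  import Data.Rational as ℚ
  open import Data.Rational.Properties using (toℚᵘ-homo-∣-∣; toℚᵘ-homo-+; toℚᵘ-homo‿-; toℚᵘ-fromℚᵘ; toℚᵘ-cancel-<)
  open import Data.Rational.Unnormalised as ℚᵘ using (ℚᵘ; mkℚᵘ; *<*) renaming (_≃_ to _≃ᵘ_; _<_ to _<ᵘ_)
  import Data.Rational.Unnormalised.Properties as ℚᵘ
  open import Data.Product using (Σ; _,_)
  open import Data.Empty using (⊥-elim)
  open import Relation.Binary.PropositionalEquality
  open import Defs using (RatioTendsTo)

  ratio-close : ∀ a b′ e d (ε : ℚ) p q → toℚᵘ ε ≡ mkℚᵘ (+ suc p) q → e ℕ.* suc b′ ≤ a ℕ.* d →
                (a ℕ.* d ∸ e ℕ.* suc b′) ℕ.* suc q < suc p ℕ.* (d ℕ.* suc b′) →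
                Σ (NonZero d) λ nz → abs ((+ e / d) {{nz}} - + a / suc b′) <ℚ ε
  ratio-close a b′ e zero     ε p q _    _  small =
    ⊥-elim (ℕ.n≮0 (subst ((a ℕ.* 0 ∸ e ℕ.* suc b′) ℕ.* suc q <_) (ℕ.*-zeroʳ (suc p)) small))
  ratio-close a b′ e (suc d′) ε@(mkℚ _ _ _) p q refl le small =
    _ , toℚᵘ-cancel-< (ℚᵘ.<-respˡ-≃ (ℚᵘ.≃-sym unnormalise) (*<* (subst (ℤ._< _) (sym numerator) (ℤ.+<+ small))))
    where
    b d : ℕ
    b = suc b′
    d = suc d′
    X Y : ℚᵘ
    X = mkℚᵘ (+ e) d′
    Y = mkℚᵘ (+ a) b′
    P Q : ℚ
    P = + e / d
    Q = + a / b
    unnormalise : toℚᵘ (abs (P - Q)) ≃ᵘ ℚᵘ.∣ X ℚᵘ.+ ℚᵘ.- Y ∣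
    unnormalise = ℚᵘ.≃-trans (toℚᵘ-homo-∣-∣ (P - Q)) (ℚᵘ.∣-∣-cong (ℚᵘ.≃-trans (toℚᵘ-homo-+ P (ℚ.- Q))
                    (ℚᵘ.+-cong (toℚᵘ-fromℚᵘ X) (ℚᵘ.≃-trans (toℚᵘ-homo‿- Q) (ℚᵘ.-‿cong (toℚᵘ-fromℚᵘ Y))))))
    numerator : + ℤ.∣ + e ℤ.* + b ℤ.+ ℤ.- (+ a) ℤ.* + d ∣ ℤ.* + suc q ≡ + ((a ℕ.* d ∸ e ℕ.* b) ℕ.* suc q)
    numerator = begin
      + ℤ.∣ + e ℤ.* + b ℤ.+ ℤ.- (+ a) ℤ.* + d ∣ ℤ.* + suc q
        ≡⟨ cong (λ z → + ℤ.∣ z ∣ ℤ.* + suc q) (cong₂ ℤ._+_ (sym (ℤ.pos-* e b))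
             (trans (sym (ℤ.neg-distribˡ-* (+ a) (+ d))) (cong ℤ.-_ (sym (ℤ.pos-* a d))))) ⟩
      + ℤ.∣ + (e ℕ.* b) ℤ.- + (a ℕ.* d) ∣ ℤ.* + suc q
        ≡⟨ cong (λ z → + ℤ.∣ z ∣ ℤ.* + suc q) (ℤ.m-n≡m⊖n (e ℕ.* b) (a ℕ.* d)) ⟩
      + ℤ.∣ e ℕ.* b ⊖ a ℕ.* d ∣ ℤ.* + suc q
        ≡⟨ cong (λ z → + z ℤ.* + suc q) (trans (ℤ.∣m⊖n∣≡∣n⊖m∣ (e ℕ.* b) (a ℕ.* d)) (cong ℤ.∣_∣ (ℤ.⊖-≥ le))) ⟩
      + (a ℕ.* d ∸ e ℕ.* b) ℤ.* + suc q
        ≡⟨ ℤ.pos-* (a ℕ.* d ∸ e ℕ.* b) (suc q) ⟨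
      + ((a ℕ.* d ∸ e ℕ.* b) ℕ.* suc q) ∎
      where open ≡-Reasoning

  ratio-limit : ∀ {a b} .{{_ : NonZero b}} (e d : ℕ → ℕ) →
                (∀ i → e i ℕ.* b ≤ a ℕ.* d i) →
                (∀ i → (a ℕ.* d i ∸ e i ℕ.* b) ℕ.* suc i < d i ℕ.* b) →
                RatioTendsTo e d (+ a / b)
  ratio-limit e d below defect (mkℚ (+ zero)   _ _) (ℚ.*<* (ℤ.+<+ ()))
  ratio-limit e d below defect (mkℚ -[1+ _ ]   _ _) (ℚ.*<* ())
  ratio-limit {a} {suc b′} e d below defect ε@(mkℚ (+ suc p) q _) _ =
    q , λ i q≤i → ratio-close a b′ (e i) (d i) ε p q refl (below i) (begin-strict
      D i ℕ.* suc q          ≤⟨ ℕ.*-monoʳ-≤ (D i) (s≤s q≤i) ⟩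
      D i ℕ.* suc i          <⟨ defect i ⟩
      d i ℕ.* suc b′         ≤⟨ ℕ.m≤n*m (d i ℕ.* suc b′) (suc p) ⟩
      suc p ℕ.* (d i ℕ.* suc b′) ∎)
    where
    open ℕ.≤-Reasoning
    D : ℕ → ℕ
    D i = a ℕ.* d i ∸ e i ℕ.* suc b′


open import Defs
open import Data.Nat using (ℕ; zero; suc; _+_; _*_; _∸_; _^_; _≤_; _<_; z≤n; s≤s; s≤s⁻¹)
open import Data.Nat.Properties using (m≤m+n; m≤n+m; +-suc; +-mono-≤; m^n>0; +-identityʳ; ≤-trans; module ≤-Reasoning)
open import Data.Nat.Combinatorics using (_C_)
open import Data.Integer using (+_)
open import Data.Rational using (_/_)
open import Data.Product using (Σ; _×_; _,_; proj₁; proj₂)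
open import Data.List.Properties using (length-map)
open import Relation.Binary.PropositionalEquality
open Enumeration using (apexTriples; length-apexTriples)
open Counting using (two-sevenths)
open Limit using (ratio-limit)

apexHypergraph : ℕ → Hypergraph 4
apexHypergraph i = Apex.H (3 + i) (m≤m+n 3 i)

pow-bound : ∀ i → 4 + i ≤ 2 ^ (3 + i)
pow-bound zero    = s≤s (s≤s (s≤s (s≤s z≤n)))
pow-bound (suc i) = begin
  4 + suc i                 ≡⟨ +-suc 4 i ⟩
  1 + (4 + i)               ≤⟨ +-mono-≤ (m^n>0 2 (3 + i)) (pow-bound i) ⟩
  2 ^ (3 + i) + 2 ^ (3 + i) ≡⟨ cong (λ x → 2 ^ (3 + i) + x) (+-identityʳ (2 ^ (3 + i))) ⟨
  2 ^ (3 + suc i)           ∎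
  where open ≤-Reasoning

vertex-bound : ∀ i → 3 + i ≤ n (apexHypergraph i)
vertex-bound i = s≤s⁻¹ (subst (4 + i ≤_) (sym (Apex.suc-N (3 + i) (m≤m+n 3 i))) (pow-bound i))

vertices→∞ : TendsToInfinity (λ i → n (apexHypergraph i))
vertices→∞ M = M , λ i M≤i → ≤-trans M≤i (≤-trans (m≤n+m i 3) (vertex-bound i))

edge-count : ∀ i → let n′ = n (apexHypergraph i) ; E = #edges (apexHypergraph i) in
             21 * E + 7 * (suc n′ * suc n′) + 8 ≡ suc n′ * suc n′ * suc n′ + 14 * suc n′
edge-count i = subst₂ (λ E m → 21 * E + 7 * (m * m) + 8 ≡ m * m * m + 14 * m)
  (sym (length-map _ (apexTriples k))) (sym (Apex.suc-N k (m≤m+n 3 i))) (length-apexTriples k)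
  where
  k : ℕ
  k = 3 + i

theorem7 : Σ (ℕ → Hypergraph 4) λ H → (((i : ℕ) → Is2Hypertree {4} (H i))
             × TendsToInfinity (λ i → n (H i))
             × RatioTendsTo (λ i → #edges (H i)) (λ i → n (H i) C 3) ((+ 2) / 7))
theorem7 = apexHypergraph
         , (λ i → Apex.is-2-hypertree (3 + i) (m≤m+n 3 i))
         , vertices→∞
         , ratio-limit {2} {7} E T (λ i → proj₁ (estimates i)) (λ i → proj₂ (estimates i))
  where
  E T : ℕ → ℕ
  E i = #edges (apexHypergraph i)
  T i = n (apexHypergraph i) C 3
  estimates : ∀ i → E i * 7 ≤ 2 * T i × (2 * T i ∸ E i * 7) * suc i < T i * 7
  estimates i = two-sevenths (n (apexHypergraph i)) (E i) i (vertex-bound i) (edge-count i)
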